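{- In $\mathbf{Gpd}$, consider functors $f^L_A:L\to A$, $f^M_A:M\to A$, $f^M_B:M\to B$, $f^R_B:R\to B$, together with three pullback squares: - (1) $P$ with projections $\mathrm{pl}^P_L:P\to L$, $\mathrm{pr}^P_M:P\to M$ is a pullback of $L\xrightarrow{f^L_A}A\xleftarrow{f^M_A}M$; - (3) $Q$ with projections $\mathrm{pl}^Q_M:Q\to M$, $\mathrm{pr}^Q_R:Q\to R$ is a pullback of $M\xrightarrow{f^M_B}B\xleftarrow{f^R_B}R$; - (2) $S$ with projections $\mathrm{pl}^S_P:S\to P$, $\mathrm{pr}^S_Q:S\to Q$ is a pullback of $P\xrightarrow{\mathrm{pr}^P_M}M\xleftarrow{\mathrm{pl}^Q_M}Q$. Let (4) be the commuting square with vertex $S$, legs $\mathrm{pr}^P_M\circ\mathrm{pl}^S_P:S\to M$ and $\langle\mathrm{pl}^P_L\circ\mathrm{pl}^S_P,\mathrm{pr}^Q_R\circ\mathrm{pr}^S_Q\rangle:S\to L\times R$, over the cospan $M\xrightarrow{\langle f^M_A,f^M_B\rangle}A\times B\xleftarrow{f^L_A\times f^R_B}L\times R$. Let (1+2) be the square with vertex $S$, legs $\mathrm{pl}^P_L\mathrm{pl}^S_P:S\to L$ and $\mathrm{pr}^S_Q:S\to Q$, over the cospan $L\xrightarrow{f^L_A}A\xleftarrow{f^M_A\mathrm{pl}^Q_M}Q$. Let (2+3) be the square with vertex $S$, legs $\mathrm{pl}^S_P:S\to P$ and $\mathrm{pr}^Q_R\mathrm{pr}^S_Q:S\to R$, over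 the cospan $P\xrightarrow{f^M_B\mathrm{pr}^P_M}B\xleftarrow{f^R_B}R$. Then (4) is a pullback. Moreover: (i) if (1) and (2+3) are bipullbacks, then (4) is a bipullback; (ii) if (3) and (1+2) are bipullbacks, then (4) is a bipullback; (iii) if (4) is a bipullback, then (1+2) and (2+3) are bipullbacks.
   Context: $\mathbf{Gpd}$ is the $2$-category of small groupoids, functors and natural transformations. For a cospan $S\xrightarrow{u}B\xleftarrow{v}T$: - A pseudocone with vertex $X$ is $(l',r',\nu)$ with $l':X\to S$, $r':X\to T$ and $\nu:ul'\Rightarrow vr'$. - A morphism $(l',r',\nu)\to(l'',r'',\nu'')$ is $(\alpha:l'\Rightarrow l'',\beta:r'\Rightarrow r'')$ with $\nu''\circ(u\alpha)=(v\beta)\circ\nu$. - A pseudocone $(P,l,r,\mu)$ is a bipullback if for every groupoid $X$ the functor $\mathbf{Gpd}(X,P)\to\{\text{pseudocones with vertex }X\}$, $h\mapsto(lh,rh,\mu h)$, is an equivalence of categories. - Commuting squares are regarded as pseudocones with identity $2$-cell. -}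

module Defs where

open import Data.Product using (Σ; _×_; _,_; proj₁; proj₂; Σ-syntax)
open import Relation.Binary.PropositionalEquality
  using (_≡_; refl; sym; trans; cong; cong₂; subst; subst₂; module ≡-Reasoning)

record Groupoid : Set₁ where
  infixr 9 _∘_
  field
    Obj       : Set
    Hom       : Obj → Obj → Set
    id        : ∀ {x} → Hom x x
    _∘_       : ∀ {x y z} → Hom y z → Hom x y → Hom x z
    _⁻¹       : ∀ {x y} → Hom x y → Hom y x
    assoc     : ∀ {w x y z} (f : Hom w x) (g : Hom x y) (h : Hom y z) →
                (h ∘ g) ∘ f ≡ h ∘ (g ∘ f)
    identityˡ : ∀ {x y} (f : Hom x y) → id ∘ f ≡ f
    identityʳ : ∀ {x y} (f : Hom x y) → f ∘ id ≡ f
    inverseˡ  : ∀ {x y} (f : Hom x y) → (f ⁻¹) ∘ f ≡ id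
    inverseʳ  : ∀ {x y} (f : Hom x y) → f ∘ (f ⁻¹) ≡ id

open Groupoid using (Obj; Hom)

record Functor (C D : Groupoid) : Set where
  field
    F₀ : Obj C → Obj D
    F₁ : ∀ {x y} → Hom C x y → Hom D (F₀ x) (F₀ y)
    identity : ∀ {x} → F₁ (Groupoid.id C {x}) ≡ Groupoid.id D
    homomorphism : ∀ {x y z} (f : Hom C x y) (g : Hom C y z) →
                   F₁ (Groupoid._∘_ C g f) ≡ Groupoid._∘_ D (F₁ g) (F₁ f)

open Functor using (F₀; F₁)

infixr 9 _∘F_
_∘F_ : ∀ {B C D} → Functor C D → Functor B C → Functor B D
G ∘F F = record
  { F₀ = λ x → F₀ G (F₀ F x)
  ; F₁ = λ f → F₁ G (F₁ F f)
  ; identity = trans (cong (F₁ G) (Functor.identity F)) (Functor.identity G)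
  ; homomorphism = λ f g → trans (cong (F₁ G) (Functor.homomorphism F f g))
                                 (Functor.homomorphism G (F₁ F f) (F₁ F g))
  }

record _≡F_ {C D : Groupoid} (F G : Functor C D) : Set where
  field
    eq₀ : ∀ x → F₀ F x ≡ F₀ G x
    eq₁ : ∀ {x y} (f : Hom C x y) →
          subst₂ (Hom D) (eq₀ x) (eq₀ y) (F₁ F f) ≡ F₁ G f

open _≡F_

record NatTrans {C D : Groupoid} (F G : Functor C D) : Set where
  field
    η : ∀ x → Hom D (F₀ F x) (F₀ G x)
    commute : ∀ {x y} (f : Hom C x y) →
              Groupoid._∘_ D (η y) (F₁ F f) ≡ Groupoid._∘_ D (F₁ G f) (η x)

open NatTrans using (η; commute)

_×G_ : Groupoid → Groupoid → Groupoid
C ×G D = record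
  { Obj = Obj C × Obj D
  ; Hom = λ p q → Hom C (proj₁ p) (proj₁ q) × Hom D (proj₂ p) (proj₂ q)
  ; id = C.id , D.id
  ; _∘_ = λ g f → (proj₁ g C.∘ proj₁ f) , (proj₂ g D.∘ proj₂ f)
  ; _⁻¹ = λ f → (proj₁ f C.⁻¹) , (proj₂ f D.⁻¹)
  ; assoc = λ f g h → cong₂ _,_ (C.assoc _ _ _) (D.assoc _ _ _)
  ; identityˡ = λ f → cong₂ _,_ (C.identityˡ _) (D.identityˡ _)
  ; identityʳ = λ f → cong₂ _,_ (C.identityʳ _) (D.identityʳ _)
  ; inverseˡ = λ f → cong₂ _,_ (C.inverseˡ _) (D.inverseˡ _)
  ; inverseʳ = λ f → cong₂ _,_ (C.inverseʳ _) (D.inverseʳ _)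
  }
  where module C = Groupoid C
        module D = Groupoid D

⟨_,_⟩F : ∀ {X C D} → Functor X C → Functor X D → Functor X (C ×G D)
⟨ F , G ⟩F = record
  { F₀ = λ x → F₀ F x , F₀ G x
  ; F₁ = λ f → F₁ F f , F₁ G f
  ; identity = cong₂ _,_ (Functor.identity F) (Functor.identity G)
  ; homomorphism = λ f g → cong₂ _,_ (Functor.homomorphism F f g)
                                     (Functor.homomorphism G f g)
  }

_×F_ : ∀ {C C' D D'} → Functor C C' → Functor D D' → Functor (C ×G D) (C' ×G D')
F ×F G = record
  { F₀ = λ p → F₀ F (proj₁ p) , F₀ G (proj₂ p)
  ; F₁ = λ f → F₁ F (proj₁ f) , F₁ G (proj₂ f)
  ; identity = cong₂ _,_ (Functor.identity F) (Functor.identity G)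
  ; homomorphism = λ f g → cong₂ _,_ (Functor.homomorphism F _ _)
                                     (Functor.homomorphism G _ _)
  }

private
  subst₂-trans : ∀ {A : Set} (H : A → A → Set) {a a' a'' b b' b'' : A}
                 (p : a ≡ a') (p' : a' ≡ a'') (q : b ≡ b') (q' : b' ≡ b'')
                 (g : H a b) →
                 subst₂ H (trans p p') (trans q q') g ≡ subst₂ H p' q' (subst₂ H p q g)
  subst₂-trans H refl refl refl refl g = refl

  subst₂-sym : ∀ {A : Set} (H : A → A → Set) {a a' b b' : A}
               (p : a ≡ a') (q : b ≡ b') (g : H a b) (g' : H a' b') →
               subst₂ H p q g ≡ g' → subst₂ H (sym p) (sym q) g' ≡ g
  subst₂-sym H refl refl g g' e = sym e

  subst₂-cong : ∀ {C D : Groupoid} (F : Functor C D) {a a' b b' : Obj C}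
                (p : a ≡ a') (q : b ≡ b') (g : Hom C a b) →
                subst₂ (Hom D) (cong (F₀ F) p) (cong (F₀ F) q) (F₁ F g)
                  ≡ F₁ F (subst₂ (Hom C) p q g)
  subst₂-cong F refl refl g = refl

  subst₂-pair : ∀ {C D : Groupoid} {a a' b b' : Obj C} {c c' d d' : Obj D}
                (p : a ≡ a') (q : b ≡ b') (p' : c ≡ c') (q' : d ≡ d')
                (g : Hom C a b) (g' : Hom D c d) →
                subst₂ (Hom (C ×G D)) (cong₂ _,_ p p') (cong₂ _,_ q q') (g , g')
                  ≡ (subst₂ (Hom C) p q g , subst₂ (Hom D) p' q' g')
  subst₂-pair refl refl refl refl g g' = refl

≡F-trans : ∀ {C D} {F G H : Functor C D} → F ≡F G → G ≡F H → F ≡F H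
≡F-trans {C} {D} {F} e e' = record
  { eq₀ = λ x → trans (eq₀ e x) (eq₀ e' x)
  ; eq₁ = λ {x} {y} f →
      trans (subst₂-trans (Hom D) (eq₀ e x) (eq₀ e' x) (eq₀ e y) (eq₀ e' y) (F₁ F f))
            (trans (cong (subst₂ (Hom D) (eq₀ e' x) (eq₀ e' y)) (eq₁ e f)) (eq₁ e' f))
  }

≡F-sym : ∀ {C D} {F G : Functor C D} → F ≡F G → G ≡F F
≡F-sym {C} {D} {F} {G} e = record
  { eq₀ = λ x → sym (eq₀ e x)
  ; eq₁ = λ {x} {y} f → subst₂-sym (Hom D) (eq₀ e x) (eq₀ e y) (F₁ F f) (F₁ G f) (eq₁ e f)
  }

_▹≡_ : ∀ {B C D} {F G : Functor C D} → F ≡F G → (H : Functor B C) →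
       (F ∘F H) ≡F (G ∘F H)
e ▹≡ H = record { eq₀ = λ x → eq₀ e (F₀ H x) ; eq₁ = λ f → eq₁ e (F₁ H f) }

_◃≡_ : ∀ {C D E} {F G : Functor C D} (H : Functor D E) → F ≡F G →
       (H ∘F F) ≡F (H ∘F G)
_◃≡_ {C} {D} {E} {F} H e = record
  { eq₀ = λ x → cong (F₀ H) (eq₀ e x)
  ; eq₁ = λ {x} {y} f → trans (subst₂-cong H (eq₀ e x) (eq₀ e y) (F₁ F f))
                              (cong (F₁ H) (eq₁ e f))
  }

⟨_,_⟩≡ : ∀ {X C D} {F F' : Functor X C} {G G' : Functor X D} →
         F ≡F F' → G ≡F G' → ⟨ F , G ⟩F ≡F ⟨ F' , G' ⟩F
⟨_,_⟩≡ {X} {C} {D} {F = F} {G = G} e₁ e₂ = record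
  { eq₀ = λ x → cong₂ _,_ (eq₀ e₁ x) (eq₀ e₂ x)
  ; eq₁ = λ {x} {y} f →
      trans (subst₂-pair {C} {D} (eq₀ e₁ x) (eq₀ e₁ y) (eq₀ e₂ x) (eq₀ e₂ y) (F₁ F f) (F₁ G f))
            (cong₂ _,_ (eq₁ e₁ f) (eq₁ e₂ f))
  }

private
  transport-nat : ∀ (D : Groupoid) {a a' b b' : Obj D} (p : a ≡ a') (q : b ≡ b')
                  (g : Hom D a b) →
                  Groupoid._∘_ D (subst (Hom D b) q (Groupoid.id D)) g
                    ≡ Groupoid._∘_ D (subst₂ (Hom D) p q g) (subst (Hom D a) p (Groupoid.id D))
  transport-nat D refl refl g = trans (Groupoid.identityˡ D g) (sym (Groupoid.identityʳ D g))

≡F⇒NatTrans : ∀ {C D} {F G : Functor C D} → F ≡F G → NatTrans F G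
≡F⇒NatTrans {C} {D} {F} {G} e = record
  { η = λ x → subst (Hom D (F₀ F x)) (eq₀ e x) (Groupoid.id D)
  ; commute = λ {x} {y} f →
      trans (transport-nat D (eq₀ e x) (eq₀ e y) (F₁ F f))
            (cong (λ k → Groupoid._∘_ D k (subst (Hom D (F₀ F x)) (eq₀ e x) (Groupoid.id D)))
                  (eq₁ e f))
  }

IsPullback : ∀ {S T B P : Groupoid} (u : Functor S B) (v : Functor T B)
             (l : Functor P S) (r : Functor P T) → Set₁
IsPullback {S} {T} {B} {P} u v l r =
  ∀ (X : Groupoid) (a : Functor X S) (b : Functor X T) → (u ∘F a) ≡F (v ∘F b) →
  Σ[ h ∈ Functor X P ]
    ((l ∘F h) ≡F a × (r ∘F h) ≡F b ×
     (∀ (h' : Functor X P) → (l ∘F h') ≡F a → (r ∘F h') ≡F b → h' ≡F h))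

record Category : Set₁ where
  infixr 9 _∘_
  infix 4 _≈_
  field
    Ob  : Set
    _⇒_ : Ob → Ob → Set
    _≈_ : ∀ {A B} → A ⇒ B → A ⇒ B → Set
    ≈-refl  : ∀ {A B} {f : A ⇒ B} → f ≈ f
    ≈-sym   : ∀ {A B} {f g : A ⇒ B} → f ≈ g → g ≈ f
    ≈-trans : ∀ {A B} {f g h : A ⇒ B} → f ≈ g → g ≈ h → f ≈ h
    id  : ∀ {A} → A ⇒ A
    _∘_ : ∀ {A B C} → B ⇒ C → A ⇒ B → A ⇒ C
    assoc : ∀ {A B C D} {f : A ⇒ B} {g : B ⇒ C} {h : C ⇒ D} →
            (h ∘ g) ∘ f ≈ h ∘ (g ∘ f)
    identityˡ : ∀ {A B} {f : A ⇒ B} → id ∘ f ≈ f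
    identityʳ : ∀ {A B} {f : A ⇒ B} → f ∘ id ≈ f
    ∘-resp-≈ : ∀ {A B C} {f h : B ⇒ C} {g i : A ⇒ B} → f ≈ h → g ≈ i → f ∘ g ≈ h ∘ i

record CFunctor (C D : Category) : Set where
  private
    module C = Category C
    module D = Category D
  field
    F₀ : C.Ob → D.Ob
    F₁ : ∀ {A B} → A C.⇒ B → F₀ A D.⇒ F₀ B
    identity : ∀ {A} → F₁ (C.id {A}) D.≈ D.id
    homomorphism : ∀ {A B C'} {f : A C.⇒ B} {g : B C.⇒ C'} →
                   F₁ (g C.∘ f) D.≈ F₁ g D.∘ F₁ f
    F-resp-≈ : ∀ {A B} {f g : A C.⇒ B} → f C.≈ g → F₁ f D.≈ F₁ g

CId : (C : Category) → CFunctor C C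
CId C = record
  { F₀ = λ A → A ; F₁ = λ f → f
  ; identity = Category.≈-refl C ; homomorphism = Category.≈-refl C
  ; F-resp-≈ = λ e → e }

_∘C_ : ∀ {C D E} → CFunctor D E → CFunctor C D → CFunctor C E
_∘C_ {C} {D} {E} G F = record
  { F₀ = λ A → G.F₀ (F.F₀ A)
  ; F₁ = λ f → G.F₁ (F.F₁ f)
  ; identity = E.≈-trans (G.F-resp-≈ F.identity) G.identity
  ; homomorphism = E.≈-trans (G.F-resp-≈ F.homomorphism) G.homomorphism
  ; F-resp-≈ = λ e → G.F-resp-≈ (F.F-resp-≈ e)
  }
  where module G = CFunctor G
        module F = CFunctor F
        module E = Category E

record NatIso {C D : Category} (F G : CFunctor C D) : Set where
  private
    module C = Category C
    module D = Category D
    module F = CFunctor F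
    module G = CFunctor G
  field
    ⇒η : ∀ A → F.F₀ A D.⇒ G.F₀ A
    ⇐η : ∀ A → G.F₀ A D.⇒ F.F₀ A
    isoˡ : ∀ A → ⇐η A D.∘ ⇒η A D.≈ D.id
    isoʳ : ∀ A → ⇒η A D.∘ ⇐η A D.≈ D.id
    natural : ∀ {A B} (f : A C.⇒ B) → ⇒η B D.∘ F.F₁ f D.≈ G.F₁ f D.∘ ⇒η A

IsCatEquivalence : ∀ {C D : Category} → CFunctor C D → Set
IsCatEquivalence {C} {D} F =
  Σ[ G ∈ CFunctor D C ] (NatIso (CId C) (G ∘C F) × NatIso (F ∘C G) (CId D))

idNT : ∀ {C D} (F : Functor C D) → NatTrans F F
idNT {C} {D} F = record
  { η = λ x → Groupoid.id D
  ; commute = λ f → trans (Groupoid.identityˡ D _) (sym (Groupoid.identityʳ D _)) }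

_∘V_ : ∀ {C D} {F G H : Functor C D} → NatTrans G H → NatTrans F G → NatTrans F H
_∘V_ {C} {D} {F} {G} {H} θ φ = record
  { η = λ x → η θ x ∘ η φ x
  ; commute = λ {x} {y} f → begin
      (η θ y ∘ η φ y) ∘ F₁ F f   ≡⟨ assoc _ _ _ ⟩
      η θ y ∘ (η φ y ∘ F₁ F f)   ≡⟨ cong (η θ y ∘_) (commute φ f) ⟩
      η θ y ∘ (F₁ G f ∘ η φ x)   ≡⟨ sym (assoc _ _ _) ⟩
      (η θ y ∘ F₁ G f) ∘ η φ x   ≡⟨ cong (_∘ η φ x) (commute θ f) ⟩
      (F₁ H f ∘ η θ x) ∘ η φ x   ≡⟨ assoc _ _ _ ⟩
      F₁ H f ∘ (η θ x ∘ η φ x)   ∎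
  }
  where open Groupoid D
        open ≡-Reasoning

FunCat : Groupoid → Groupoid → Category
FunCat X P = record
  { Ob = Functor X P
  ; _⇒_ = NatTrans
  ; _≈_ = λ θ φ → ∀ x → η θ x ≡ η φ x
  ; ≈-refl = λ x → refl
  ; ≈-sym = λ e x → sym (e x)
  ; ≈-trans = λ e e' x → trans (e x) (e' x)
  ; id = idNT _
  ; _∘_ = _∘V_
  ; assoc = λ x → P.assoc _ _ _
  ; identityˡ = λ x → P.identityˡ _
  ; identityʳ = λ x → P.identityʳ _
  ; ∘-resp-≈ = λ e e' x → cong₂ P._∘_ (e x) (e' x)
  }
  where module P = Groupoid P

record Pseudocone {S T B : Groupoid} (u : Functor S B) (v : Functor T B)
                  (X : Groupoid) : Set where
  field
    l' : Functor X S
    r' : Functor X T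
    ν  : NatTrans (u ∘F l') (v ∘F r')

open Pseudocone

record PCMor {S T B : Groupoid} {u : Functor S B} {v : Functor T B} {X : Groupoid}
             (c d : Pseudocone u v X) : Set where
  field
    α : NatTrans (l' c) (l' d)
    β : NatTrans (r' c) (r' d)
    cond : ∀ x → Groupoid._∘_ B (η (ν d) x) (F₁ u (η α x))
               ≡ Groupoid._∘_ B (F₁ v (η β x)) (η (ν c) x)

open PCMor

PCCat : ∀ {S T B : Groupoid} (u : Functor S B) (v : Functor T B) (X : Groupoid) →
        Category
PCCat {S} {T} {B} u v X = record
  { Ob = Pseudocone u v X
  ; _⇒_ = PCMor
  ; _≈_ = λ m n → (∀ x → η (α m) x ≡ η (α n) x) × (∀ x → η (β m) x ≡ η (β n) x)
  ; ≈-refl = (λ x → refl) , (λ x → refl)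
  ; ≈-sym = λ e → (λ x → sym (proj₁ e x)) , (λ x → sym (proj₂ e x))
  ; ≈-trans = λ e e' → (λ x → trans (proj₁ e x) (proj₁ e' x))
                     , (λ x → trans (proj₂ e x) (proj₂ e' x))
  ; id = λ {c} → record
      { α = idNT _ ; β = idNT _
      ; cond = λ x → trans (cong (η (ν c) x B.∘_) (Functor.identity u))
                     (trans (B.identityʳ _)
                     (sym (trans (cong (B._∘ η (ν c) x) (Functor.identity v))
                                 (B.identityˡ _)))) }
  ; _∘_ = comp
  ; assoc = (λ x → Groupoid.assoc S _ _ _) , (λ x → Groupoid.assoc T _ _ _)
  ; identityˡ = (λ x → Groupoid.identityˡ S _) , (λ x → Groupoid.identityˡ T _)
  ; identityʳ = (λ x → Groupoid.identityʳ S _) , (λ x → Groupoid.identityʳ T _)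
  ; ∘-resp-≈ = λ e e' → (λ x → cong₂ (Groupoid._∘_ S) (proj₁ e x) (proj₁ e' x))
                      , (λ x → cong₂ (Groupoid._∘_ T) (proj₂ e x) (proj₂ e' x))
  }
  where
    module B = Groupoid B
    comp : ∀ {c d e : Pseudocone u v X} → PCMor d e → PCMor c d → PCMor c e
    comp {c} {d} {e} g f = record
      { α = α g ∘V α f
      ; β = β g ∘V β f
      ; cond = λ x → begin
          η (ν e) x B.∘ F₁ u (Groupoid._∘_ S (η (α g) x) (η (α f) x))
            ≡⟨ cong (η (ν e) x B.∘_) (Functor.homomorphism u _ _) ⟩
          η (ν e) x B.∘ (F₁ u (η (α g) x) B.∘ F₁ u (η (α f) x))
            ≡⟨ sym (B.assoc _ _ _) ⟩
          (η (ν e) x B.∘ F₁ u (η (α g) x)) B.∘ F₁ u (η (α f) x)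
            ≡⟨ cong (B._∘ F₁ u (η (α f) x)) (cond g x) ⟩
          (F₁ v (η (β g) x) B.∘ η (ν d) x) B.∘ F₁ u (η (α f) x)
            ≡⟨ B.assoc _ _ _ ⟩
          F₁ v (η (β g) x) B.∘ (η (ν d) x B.∘ F₁ u (η (α f) x))
            ≡⟨ cong (F₁ v (η (β g) x) B.∘_) (cond f x) ⟩
          F₁ v (η (β g) x) B.∘ (F₁ v (η (β f) x) B.∘ η (ν c) x)
            ≡⟨ sym (B.assoc _ _ _) ⟩
          (F₁ v (η (β g) x) B.∘ F₁ v (η (β f) x)) B.∘ η (ν c) x
            ≡⟨ cong (B._∘ η (ν c) x) (sym (Functor.homomorphism v _ _)) ⟩
          F₁ v (Groupoid._∘_ T (η (β g) x) (η (β f) x)) B.∘ η (ν c) x ∎ }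
      where open ≡-Reasoning

Compare : ∀ {S T B P : Groupoid} (u : Functor S B) (v : Functor T B)
          (l : Functor P S) (r : Functor P T) (μ : NatTrans (u ∘F l) (v ∘F r))
          (X : Groupoid) → CFunctor (FunCat X P) (PCCat u v X)
Compare {S} {T} {B} {P} u v l r μ X = record
  { F₀ = λ h → record
      { l' = l ∘F h ; r' = r ∘F h
      ; ν = record { η = λ x → η μ (F₀ h x) ; commute = λ f → commute μ (F₁ h f) } }
  ; F₁ = λ θ → record
      { α = whisk l θ ; β = whisk r θ ; cond = λ x → commute μ (η θ x) }
  ; identity = (λ x → Functor.identity l) , (λ x → Functor.identity r)
  ; homomorphism = (λ x → Functor.homomorphism l _ _) , (λ x → Functor.homomorphism r _ _)
  ; F-resp-≈ = λ e → (λ x → cong (F₁ l) (e x)) , (λ x → cong (F₁ r) (e x))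
  }
  where
    whisk : ∀ {D} (k : Functor P D) {h h' : Functor X P} → NatTrans h h' →
            NatTrans (k ∘F h) (k ∘F h')
    whisk k θ = record
      { η = λ x → F₁ k (η θ x)
      ; commute = λ f → trans (sym (Functor.homomorphism k _ _))
                        (trans (cong (F₁ k) (commute θ f)) (Functor.homomorphism k _ _)) }

IsBipullback : ∀ {S T B P : Groupoid} (u : Functor S B) (v : Functor T B)
               (l : Functor P S) (r : Functor P T) (μ : NatTrans (u ∘F l) (v ∘F r)) →
               Set₁
IsBipullback u v l r μ = ∀ (X : Groupoid) → IsCatEquivalence (Compare u v l r μ X)

IsBipullbackSq : ∀ {S T B P : Groupoid} (u : Functor S B) (v : Functor T B)
                 (l : Functor P S) (r : Functor P T) → (u ∘F l) ≡F (v ∘F r) → Set₁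
IsBipullbackSq u v l r comm = IsBipullback u v l r (≡F⇒NatTrans comm)

module Squares
  {L A M B R P Q S : Groupoid}
  (fLA : Functor L A) (fMA : Functor M A) (fMB : Functor M B) (fRB : Functor R B)
  (plPL : Functor P L) (prPM : Functor P M)
  (sq1 : (fLA ∘F plPL) ≡F (fMA ∘F prPM))
  (plQM : Functor Q M) (prQR : Functor Q R)
  (sq3 : (fMB ∘F plQM) ≡F (fRB ∘F prQR))
  (plSP : Functor S P) (prSQ : Functor S Q)
  (sq2 : (prPM ∘F plSP) ≡F (plQM ∘F prSQ))
  where

  comm4 : (⟨ fMA , fMB ⟩F ∘F (prPM ∘F plSP))
            ≡F ((fLA ×F fRB) ∘F ⟨ plPL ∘F plSP , prQR ∘F prSQ ⟩F)
  comm4 = record { eq₀ = eq₀ e ; eq₁ = eq₁ e }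
    where
      e₁ : (fMA ∘F (prPM ∘F plSP)) ≡F (fLA ∘F (plPL ∘F plSP))
      e₁ = let s = ≡F-sym (sq1 ▹≡ plSP) in record { eq₀ = eq₀ s ; eq₁ = eq₁ s }
      e₂ : (fMB ∘F (prPM ∘F plSP)) ≡F (fRB ∘F (prQR ∘F prSQ))
      e₂ = let a = fMB ◃≡ sq2
               b = sq3 ▹≡ prSQ
               s = ≡F-trans {F = fMB ∘F (prPM ∘F plSP)} {G = fMB ∘F (plQM ∘F prSQ)}
                     {H = fRB ∘F (prQR ∘F prSQ)}
                     (record { eq₀ = eq₀ a ; eq₁ = eq₁ a })
                     (record { eq₀ = eq₀ b ; eq₁ = eq₁ b })
           in record { eq₀ = eq₀ s ; eq₁ = eq₁ s }
      e = ⟨ e₁ , e₂ ⟩≡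

  comm12 : (fLA ∘F (plPL ∘F plSP)) ≡F ((fMA ∘F plQM) ∘F prSQ)
  comm12 = record { eq₀ = eq₀ s ; eq₁ = eq₁ s }
    where
      a = sq1 ▹≡ plSP
      b = fMA ◃≡ sq2
      s = ≡F-trans {F = fLA ∘F (plPL ∘F plSP)} {G = fMA ∘F (prPM ∘F plSP)}
            {H = fMA ∘F (plQM ∘F prSQ)}
            (record { eq₀ = eq₀ a ; eq₁ = eq₁ a })
            (record { eq₀ = eq₀ b ; eq₁ = eq₁ b })

  comm23 : ((fMB ∘F prPM) ∘F plSP) ≡F (fRB ∘F (prQR ∘F prSQ))
  comm23 = record { eq₀ = eq₀ s ; eq₁ = eq₁ s }
    where
      a = fMB ◃≡ sq2
      b = sq3 ▹≡ prSQ
      s = ≡F-trans {F = fMB ∘F (prPM ∘F plSP)} {G = fMB ∘F (plQM ∘F prSQ)}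
            {H = fRB ∘F (prQR ∘F prSQ)}
            (record { eq₀ = eq₀ a ; eq₁ = eq₁ a })
            (record { eq₀ = eq₀ b ; eq₁ = eq₁ b })

-- A pseudocone is a bipullback exactly when every comparison functor
-- Gpd(X, P) → PC(X) is fully faithful and essentially surjective, so each part
-- is a statement about comparison functors. A pseudocone over the cospan of (4)
-- amounts to a pseudocone over (1) followed by one over (2+3), or over (3)
-- followed by one over (1+2), glued along the 2-cell of (2); lifting objects and
-- morphisms through the two stages gives (i) and (ii). For (iii) the outer stage
-- is read off from (4), and the inner one comes from the strict pullbacks (1)
-- and (3), whose comparison functors are always fully faithful. That (4) is a
-- strict pullback is the pasting of the three strict pullbacks.
module Submission where

open import Defs
open import Axiom.UniquenessOfIdentityProofs.WithK using (uip)
open import Data.Bool using (Bool; true; false)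
open import Data.Product using (Σ; _×_; _,_; proj₁; proj₂; Σ-syntax)
open import Data.Unit using (⊤; tt)
open import Relation.Binary.PropositionalEquality
  using (_≡_; refl; sym; trans; cong; cong₂; subst; subst₂; module ≡-Reasoning)

open Groupoid using (Obj; Hom)
open Functor using (F₀; F₁)
open NatTrans using (η; commute)
open _≡F_
open Pseudocone
open PCMor

module GroupoidProperties (G : Groupoid) where
  open Groupoid G public
  open ≡-Reasoning

  cancelˡ : ∀ {a b c} {f : Hom G b c} {g : Hom G c b} {h : Hom G a b} →
            g ∘ f ≡ id → g ∘ (f ∘ h) ≡ h
  cancelˡ {h = h} e = trans (sym (assoc _ _ _)) (trans (cong (_∘ h) e) (identityˡ h))

  cancelʳ : ∀ {a b c} {f : Hom G a b} {g : Hom G b a} {h : Hom G b c} →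
            f ∘ g ≡ id → (h ∘ f) ∘ g ≡ h
  cancelʳ {h = h} e = trans (assoc _ _ _) (trans (cong (h ∘_) e) (identityʳ h))

  monic : ∀ {a b c} {k : Hom G b c} {f f' : Hom G a b} → k ∘ f ≡ k ∘ f' → f ≡ f'
  monic {k = k} {f} {f'} e = begin
    f                   ≡⟨ sym (cancelˡ (inverseˡ k)) ⟩
    (k ⁻¹) ∘ (k ∘ f)    ≡⟨ cong ((k ⁻¹) ∘_) e ⟩
    (k ⁻¹) ∘ (k ∘ f')   ≡⟨ cancelˡ (inverseˡ k) ⟩
    f'                  ∎

  epic : ∀ {a b c} {j : Hom G a b} {f f' : Hom G b c} → f ∘ j ≡ f' ∘ j → f ≡ f'
  epic {j = j} {f} {f'} e = begin
    f                   ≡⟨ sym (cancelʳ (inverseʳ j)) ⟩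
    (f ∘ j) ∘ (j ⁻¹)    ≡⟨ cong (_∘ (j ⁻¹)) e ⟩
    (f' ∘ j) ∘ (j ⁻¹)   ≡⟨ cancelʳ (inverseʳ j) ⟩
    f'                  ∎

  ⁻¹-unique : ∀ {a b} {f : Hom G a b} {g : Hom G b a} → g ∘ f ≡ id → g ≡ f ⁻¹
  ⁻¹-unique {f = f} e = epic (trans e (sym (inverseˡ f)))

  ⁻¹-involutive : ∀ {a b} (f : Hom G a b) → (f ⁻¹) ⁻¹ ≡ f
  ⁻¹-involutive f = sym (⁻¹-unique (inverseʳ f))

  flipᵛ : ∀ {a b c d} {f : Hom G a b} {k : Hom G b d} {j : Hom G a c} {f' : Hom G c d} →
          k ∘ f ≡ f' ∘ j → (k ⁻¹) ∘ f' ≡ f ∘ (j ⁻¹)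
  flipᵛ {f = f} {k} {j} {f'} e = begin
    (k ⁻¹) ∘ f'                    ≡⟨ cong ((k ⁻¹) ∘_) (sym (cancelʳ (inverseʳ j))) ⟩
    (k ⁻¹) ∘ ((f' ∘ j) ∘ (j ⁻¹))   ≡⟨ cong (λ g → (k ⁻¹) ∘ (g ∘ (j ⁻¹))) (sym e) ⟩
    (k ⁻¹) ∘ ((k ∘ f) ∘ (j ⁻¹))    ≡⟨ cong ((k ⁻¹) ∘_) (assoc _ _ _) ⟩
    (k ⁻¹) ∘ (k ∘ (f ∘ (j ⁻¹)))    ≡⟨ cancelˡ (inverseˡ k) ⟩
    f ∘ (j ⁻¹)                     ∎

  flipʰ : ∀ {a b c d} {f : Hom G a b} {k : Hom G b d} {j : Hom G a c} {f' : Hom G c d} →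
          k ∘ f ≡ f' ∘ j → j ∘ (f ⁻¹) ≡ (f' ⁻¹) ∘ k
  flipʰ e = sym (flipᵛ (sym e))

  unflipᵛ : ∀ {a b c d} {f : Hom G a b} {k : Hom G b d} {j : Hom G a c} {f' : Hom G c d} →
            (k ⁻¹) ∘ f' ≡ f ∘ (j ⁻¹) → k ∘ f ≡ f' ∘ j
  unflipᵛ {f = f} {k} {j} {f'} e =
    subst₂ (λ k' j' → k' ∘ f ≡ f' ∘ j') (⁻¹-involutive k) (⁻¹-involutive j) (flipᵛ e)

  flipᵛ-⁻¹ : ∀ {a b c d} {f : Hom G a b} {k : Hom G d b} {j : Hom G a c} {f' : Hom G c d} →
             (k ⁻¹) ∘ f ≡ f' ∘ j → k ∘ f' ≡ f ∘ (j ⁻¹)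
  flipᵛ-⁻¹ {k = k} {f' = f'} e = subst (λ k' → k' ∘ f' ≡ _) (⁻¹-involutive k) (flipᵛ e)

  glue : ∀ {a b c d a' c'} {f : Hom G a b} {k : Hom G b d} {j : Hom G a c} {f' : Hom G c d}
           {g : Hom G a' a} {i : Hom G a' c'} {g' : Hom G c' c} →
         k ∘ f ≡ f' ∘ j → j ∘ g ≡ g' ∘ i → k ∘ (f ∘ g) ≡ (f' ∘ g') ∘ i
  glue {f = f} {k} {j} {f'} {g} {i} {g'} e e' = begin
    k ∘ (f ∘ g)     ≡⟨ sym (assoc _ _ _) ⟩
    (k ∘ f) ∘ g     ≡⟨ cong (_∘ g) e ⟩
    (f' ∘ j) ∘ g    ≡⟨ assoc _ _ _ ⟩
    f' ∘ (j ∘ g)    ≡⟨ cong (f' ∘_) e' ⟩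
    f' ∘ (g' ∘ i)   ≡⟨ sym (assoc _ _ _) ⟩
    (f' ∘ g') ∘ i   ∎

  ≡⇒Hom : ∀ {a b} → a ≡ b → Hom G a b
  ≡⇒Hom {a} p = subst (Hom G a) p id

  ≡⇒Hom-irrelevant : ∀ {a b} (p q : a ≡ b) → ≡⇒Hom p ≡ ≡⇒Hom q
  ≡⇒Hom-irrelevant p q = cong ≡⇒Hom (uip p q)

  ≡⇒Hom-trans : ∀ {a b c} (p : a ≡ b) (q : b ≡ c) → ≡⇒Hom (trans p q) ≡ ≡⇒Hom q ∘ ≡⇒Hom p
  ≡⇒Hom-trans refl refl = sym (identityˡ _)

  ≡⇒Hom-sym : ∀ {a b} (p : a ≡ b) → ≡⇒Hom (sym p) ≡ ≡⇒Hom p ⁻¹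
  ≡⇒Hom-sym refl = ⁻¹-unique (identityˡ _)

  subst₂-≡⇒Hom : ∀ {a a' b b'} (p : a ≡ a') (q : b ≡ b') {g : Hom G a b} {g' : Hom G a' b'} →
                 ≡⇒Hom q ∘ g ≡ g' ∘ ≡⇒Hom p → subst₂ (Hom G) p q g ≡ g'
  subst₂-≡⇒Hom refl refl {g} {g'} e = trans (sym (identityˡ g)) (trans e (identityʳ g'))

module _ {C D : Groupoid} (F : Functor C D) where
  private
    module C = GroupoidProperties C
    module D = GroupoidProperties D

  F-⁻¹ : ∀ {a b} (g : Hom C a b) → F₁ F (g C.⁻¹) ≡ F₁ F g D.⁻¹
  F-⁻¹ g = D.⁻¹-unique (trans (sym (Functor.homomorphism F g (g C.⁻¹)))
                        (trans (cong (F₁ F) (C.inverseˡ g)) (Functor.identity F)))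

  F-≡⇒Hom : ∀ {a b} (p : a ≡ b) → F₁ F (C.≡⇒Hom p) ≡ D.≡⇒Hom (cong (F₀ F) p)
  F-≡⇒Hom refl = Functor.identity F

  F-subst₂ : ∀ {a a' b b'} (p : a ≡ a') (q : b ≡ b') (g : Hom C a b) →
             F₁ F (subst₂ (Hom C) p q g) ≡ subst₂ (Hom D) (cong (F₀ F) p) (cong (F₀ F) q) (F₁ F g)
  F-subst₂ refl refl g = refl

≡⇒Hom-pair : ∀ {C D : Groupoid} {a b : Obj C} {c d : Obj D} (p : a ≡ b) (q : c ≡ d) →
             GroupoidProperties.≡⇒Hom (C ×G D) (cong₂ _,_ p q)
               ≡ (GroupoidProperties.≡⇒Hom C p , GroupoidProperties.≡⇒Hom D q)
≡⇒Hom-pair refl refl = refl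

module HomReasoning (C : Category) where
  open Category C
  infix  1 begin_
  infixr 2 _≈⟨_⟩_
  infix  3 _∎

  begin_ : ∀ {a b} {f g : a ⇒ b} → f ≈ g → f ≈ g
  begin e = e

  _≈⟨_⟩_ : ∀ {a b} (f : a ⇒ b) {g h : a ⇒ b} → f ≈ g → g ≈ h → f ≈ h
  f ≈⟨ e ⟩ e' = ≈-trans e e'

  _∎ : ∀ {a b} (f : a ⇒ b) → f ≈ f
  f ∎ = ≈-refl

  refl⟩∘⟨_ : ∀ {a b c} {f : b ⇒ c} {g h : a ⇒ b} → g ≈ h → f ∘ g ≈ f ∘ h
  refl⟩∘⟨ e = ∘-resp-≈ ≈-refl e

  _⟩∘⟨refl : ∀ {a b c} {f g : b ⇒ c} {h : a ⇒ b} → f ≈ g → f ∘ h ≈ g ∘ h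
  e ⟩∘⟨refl = ∘-resp-≈ e ≈-refl

  sym-assoc : ∀ {a b c d} {f : a ⇒ b} {g : b ⇒ c} {h : c ⇒ d} → h ∘ (g ∘ f) ≈ (h ∘ g) ∘ f
  sym-assoc = ≈-sym assoc

  cancelˡ : ∀ {a b c} {f : b ⇒ c} {g : c ⇒ b} {h : a ⇒ b} → g ∘ f ≈ id → g ∘ (f ∘ h) ≈ h
  cancelˡ e = ≈-trans sym-assoc (≈-trans (e ⟩∘⟨refl) identityˡ)

  cancelʳ : ∀ {a b c} {f : a ⇒ b} {g : b ⇒ a} {h : b ⇒ c} → f ∘ g ≈ id → (h ∘ f) ∘ g ≈ h
  cancelʳ e = ≈-trans assoc (≈-trans (refl⟩∘⟨ e) identityʳ)

record Iso (C : Category) (a b : Category.Ob C) : Set where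
  open Category C
  field
    from : a ⇒ b
    to   : b ⇒ a
    isoˡ : to ∘ from ≈ id
    isoʳ : from ∘ to ≈ id

module _ {C D : Category} (F : CFunctor C D) where
  private
    module C = Category C
    module D = Category D
    module F = CFunctor F

  Full : Set
  Full = ∀ {a b} (f : F.F₀ a D.⇒ F.F₀ b) → Σ[ g ∈ a C.⇒ b ] F.F₁ g D.≈ f

  Faithful : Set
  Faithful = ∀ {a b} (g h : a C.⇒ b) → F.F₁ g D.≈ F.F₁ h → g C.≈ h

  EssSurj : Set
  EssSurj = ∀ d → Σ[ a ∈ C.Ob ] Iso D (F.F₀ a) d

  record FullyFaithfulEssSurj : Set where
    field
      full     : Full
      faithful : Faithful
      essSurj  : EssSurj

module _ {C D : Category} {F : CFunctor C D} where
  private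
    module C = Category C
    module D = Category D
    module F = CFunctor F

  equivalence⇒fullyFaithfulEssSurj : IsCatEquivalence F → FullyFaithfulEssSurj F
  equivalence⇒fullyFaithfulEssSurj (G , unit , counit) = record
    { full = full ; faithful = faithful ; essSurj = essSurj }
    where
      module G = CFunctor G
      module η = NatIso unit
      module ε = NatIso counit

      faithful : Faithful F
      faithful {a} {b} x y e =
        C.≈-trans (conj x) (C.≈-trans (refl⟩∘⟨ (G.F-resp-≈ e ⟩∘⟨refl)) (C.≈-sym (conj y)))
        where
          open HomReasoning C
          conj : ∀ z → z C.≈ η.⇐η b C.∘ (G.F₁ (F.F₁ z) C.∘ η.⇒η a)
          conj z = C.≈-sym (begin
            η.⇐η b C.∘ (G.F₁ (F.F₁ z) C.∘ η.⇒η a) ≈⟨ refl⟩∘⟨ C.≈-sym (η.natural z) ⟩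
            η.⇐η b C.∘ (η.⇒η b C.∘ z)              ≈⟨ cancelˡ (η.isoˡ b) ⟩
            z                                      ∎)

      G-faithful : Faithful G
      G-faithful {a} {b} x y e =
        D.≈-trans (conj x) (D.≈-trans (refl⟩∘⟨ (F.F-resp-≈ e ⟩∘⟨refl)) (D.≈-sym (conj y)))
        where
          open HomReasoning D
          conj : ∀ z → z D.≈ ε.⇒η b D.∘ (F.F₁ (G.F₁ z) D.∘ ε.⇐η a)
          conj z = D.≈-sym (begin
            ε.⇒η b D.∘ (F.F₁ (G.F₁ z) D.∘ ε.⇐η a) ≈⟨ sym-assoc ⟩
            (ε.⇒η b D.∘ F.F₁ (G.F₁ z)) D.∘ ε.⇐η a ≈⟨ ε.natural z ⟩∘⟨refl ⟩
            (z D.∘ ε.⇒η a) D.∘ ε.⇐η a              ≈⟨ cancelʳ (ε.isoʳ a) ⟩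
            z                                      ∎)

      full : Full F
      full {a} {b} f = g , G-faithful _ _ GFg≈Gf
        where
          open HomReasoning C
          g = η.⇐η b C.∘ (G.F₁ f C.∘ η.⇒η a)
          GFg≈Gf : G.F₁ (F.F₁ g) C.≈ G.F₁ f
          GFg≈Gf = begin
            G.F₁ (F.F₁ g)                            ≈⟨ C.≈-sym (cancelʳ (η.isoʳ a)) ⟩
            (G.F₁ (F.F₁ g) C.∘ η.⇒η a) C.∘ η.⇐η a   ≈⟨ C.≈-sym (η.natural g) ⟩∘⟨refl ⟩
            (η.⇒η b C.∘ g) C.∘ η.⇐η a               ≈⟨ cancelˡ (η.isoʳ b) ⟩∘⟨refl ⟩
            (G.F₁ f C.∘ η.⇒η a) C.∘ η.⇐η a          ≈⟨ cancelʳ (η.isoʳ a) ⟩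
            G.F₁ f                                   ∎

      essSurj : EssSurj F
      essSurj d = G.F₀ d , record
        { from = ε.⇒η d ; to = ε.⇐η d ; isoˡ = ε.isoˡ d ; isoʳ = ε.isoʳ d }

  fullyFaithfulEssSurj⇒equivalence : FullyFaithfulEssSurj F → IsCatEquivalence F
  fullyFaithfulEssSurj⇒equivalence ffe = G , unit , counit
    where
      open FullyFaithfulEssSurj ffe
      open HomReasoning D

      G₀ : D.Ob → C.Ob
      G₀ d = proj₁ (essSurj d)

      module I (d : D.Ob) = Iso (proj₂ (essSurj d))

      conjugate : ∀ {d d'} → d D.⇒ d' → F.F₀ (G₀ d) D.⇒ F.F₀ (G₀ d')
      conjugate {d} {d'} f = I.to d' D.∘ (f D.∘ I.from d)

      G₁ : ∀ {d d'} → d D.⇒ d' → G₀ d C.⇒ G₀ d'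
      G₁ f = proj₁ (full (conjugate f))

      F-G₁ : ∀ {d d'} (f : d D.⇒ d') → F.F₁ (G₁ f) D.≈ conjugate f
      F-G₁ f = proj₂ (full (conjugate f))

      G : CFunctor D C
      G = record
        { F₀ = G₀
        ; F₁ = G₁
        ; identity = λ {d} → faithful _ _ (begin
            F.F₁ (G₁ D.id)                     ≈⟨ F-G₁ D.id ⟩
            I.to d D.∘ (D.id D.∘ I.from d)     ≈⟨ refl⟩∘⟨ D.identityˡ ⟩
            I.to d D.∘ I.from d                ≈⟨ I.isoˡ d ⟩
            D.id                               ≈⟨ D.≈-sym F.identity ⟩
            F.F₁ C.id                          ∎)
        ; homomorphism = λ {d} {d'} {d''} {f} {g} → faithful _ _ (begin
            F.F₁ (G₁ (g D.∘ f))                                ≈⟨ F-G₁ (g D.∘ f) ⟩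
            I.to d'' D.∘ ((g D.∘ f) D.∘ I.from d)              ≈⟨ refl⟩∘⟨ D.assoc ⟩
            I.to d'' D.∘ (g D.∘ (f D.∘ I.from d))
              ≈⟨ refl⟩∘⟨ (refl⟩∘⟨ D.≈-sym (cancelˡ (I.isoʳ d'))) ⟩
            I.to d'' D.∘ (g D.∘ (I.from d' D.∘ conjugate f))   ≈⟨ refl⟩∘⟨ sym-assoc ⟩
            I.to d'' D.∘ ((g D.∘ I.from d') D.∘ conjugate f)   ≈⟨ sym-assoc ⟩
            conjugate g D.∘ conjugate f                        ≈⟨ D.≈-sym (D.∘-resp-≈ (F-G₁ g) (F-G₁ f)) ⟩
            F.F₁ (G₁ g) D.∘ F.F₁ (G₁ f)                        ≈⟨ D.≈-sym F.homomorphism ⟩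
            F.F₁ (G₁ g C.∘ G₁ f)                               ∎)
        ; F-resp-≈ = λ {d} {d'} {f} {g} e → faithful _ _ (begin
            F.F₁ (G₁ f)   ≈⟨ F-G₁ f ⟩
            conjugate f   ≈⟨ refl⟩∘⟨ (e ⟩∘⟨refl) ⟩
            conjugate g   ≈⟨ D.≈-sym (F-G₁ g) ⟩
            F.F₁ (G₁ g)   ∎)
        }

      preimage : ∀ {a b} → F.F₀ a D.⇒ F.F₀ b → a C.⇒ b
      preimage f = proj₁ (full f)

      F-preimage : ∀ {a b} (f : F.F₀ a D.⇒ F.F₀ b) → F.F₁ (preimage f) D.≈ f
      F-preimage f = proj₂ (full f)

      unit : NatIso (CId C) (G ∘C F)
      unit = record
        { ⇒η = λ a → preimage (I.to (F.F₀ a))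
        ; ⇐η = λ a → preimage (I.from (F.F₀ a))
        ; isoˡ = λ a → faithful _ _ (begin
            F.F₁ (preimage (I.from (F.F₀ a)) C.∘ preimage (I.to (F.F₀ a)))
              ≈⟨ F.homomorphism ⟩
            F.F₁ (preimage (I.from (F.F₀ a))) D.∘ F.F₁ (preimage (I.to (F.F₀ a)))
              ≈⟨ D.∘-resp-≈ (F-preimage _) (F-preimage _) ⟩
            I.from (F.F₀ a) D.∘ I.to (F.F₀ a)
              ≈⟨ I.isoʳ (F.F₀ a) ⟩
            D.id
              ≈⟨ D.≈-sym F.identity ⟩
            F.F₁ C.id ∎)
        ; isoʳ = λ a → faithful _ _ (begin
            F.F₁ (preimage (I.to (F.F₀ a)) C.∘ preimage (I.from (F.F₀ a)))
              ≈⟨ F.homomorphism ⟩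
            F.F₁ (preimage (I.to (F.F₀ a))) D.∘ F.F₁ (preimage (I.from (F.F₀ a)))
              ≈⟨ D.∘-resp-≈ (F-preimage _) (F-preimage _) ⟩
            I.to (F.F₀ a) D.∘ I.from (F.F₀ a)
              ≈⟨ I.isoˡ (F.F₀ a) ⟩
            D.id
              ≈⟨ D.≈-sym F.identity ⟩
            F.F₁ C.id ∎)
        ; natural = λ {a} {b} f → faithful _ _ (begin
            F.F₁ (preimage (I.to (F.F₀ b)) C.∘ f)
              ≈⟨ F.homomorphism ⟩
            F.F₁ (preimage (I.to (F.F₀ b))) D.∘ F.F₁ f
              ≈⟨ F-preimage _ ⟩∘⟨refl ⟩
            I.to (F.F₀ b) D.∘ F.F₁ f
              ≈⟨ D.≈-sym (refl⟩∘⟨ cancelʳ (I.isoʳ (F.F₀ a))) ⟩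
            I.to (F.F₀ b) D.∘ ((F.F₁ f D.∘ I.from (F.F₀ a)) D.∘ I.to (F.F₀ a))
              ≈⟨ sym-assoc ⟩
            conjugate (F.F₁ f) D.∘ I.to (F.F₀ a)
              ≈⟨ D.≈-sym (D.∘-resp-≈ (F-G₁ (F.F₁ f)) (F-preimage _)) ⟩
            F.F₁ (G₁ (F.F₁ f)) D.∘ F.F₁ (preimage (I.to (F.F₀ a)))
              ≈⟨ D.≈-sym F.homomorphism ⟩
            F.F₁ (G₁ (F.F₁ f) C.∘ preimage (I.to (F.F₀ a))) ∎)
        }

      counit : NatIso (F ∘C G) (CId D)
      counit = record
        { ⇒η = I.from
        ; ⇐η = I.to
        ; isoˡ = I.isoˡ
        ; isoʳ = I.isoʳ
        ; natural = λ {d} {d'} f → begin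
            I.from d' D.∘ F.F₁ (G₁ f)   ≈⟨ refl⟩∘⟨ F-G₁ f ⟩
            I.from d' D.∘ conjugate f   ≈⟨ cancelˡ (I.isoʳ d') ⟩
            f D.∘ I.from d              ∎
        }

≡F-refl : ∀ {C D} {F : Functor C D} → F ≡F F
≡F-refl = record { eq₀ = λ _ → refl ; eq₁ = λ _ → refl }

subst₂-loop : ∀ {A : Set} (H : A → A → Set) {a b : A} (p : a ≡ a) (q : b ≡ b) (g : H a b) →
              subst₂ H p q g ≡ g
subst₂-loop H refl refl g = refl

Point : Groupoid
Point = record
  { Obj = ⊤ ; Hom = λ _ _ → ⊤ ; id = tt ; _∘_ = λ _ _ → tt ; _⁻¹ = λ _ → tt
  ; assoc = λ _ _ _ → refl ; identityˡ = λ _ → refl ; identityʳ = λ _ → refl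
  ; inverseˡ = λ _ → refl ; inverseʳ = λ _ → refl }

Interval : Groupoid
Interval = record
  { Obj = Bool ; Hom = λ _ _ → ⊤ ; id = tt ; _∘_ = λ _ _ → tt ; _⁻¹ = λ _ → tt
  ; assoc = λ _ _ _ → refl ; identityˡ = λ _ → refl ; identityʳ = λ _ → refl
  ; inverseˡ = λ _ → refl ; inverseʳ = λ _ → refl }

module _ (C : Groupoid) where
  open GroupoidProperties C

  const : Obj C → Functor Point C
  const a = record
    { F₀ = λ _ → a ; F₁ = λ _ → id ; identity = refl
    ; homomorphism = λ _ _ → sym (identityˡ _) }

  arrow : ∀ {a b} → Hom C a b → Functor Interval C
  arrow {a} {b} g = record
    { F₀ = arrow₀ ; F₁ = λ {x} {y} _ → arrow₁ x y
    ; identity = λ {x} → arrow₁-id x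
    ; homomorphism = λ {x} {y} {z} _ _ → arrow₁-∘ x y z }
    where
      arrow₀ : Bool → Obj C
      arrow₀ false = a
      arrow₀ true  = b

      arrow₁ : ∀ x y → Hom C (arrow₀ x) (arrow₀ y)
      arrow₁ false false = id
      arrow₁ false true  = g
      arrow₁ true  false = g ⁻¹
      arrow₁ true  true  = id

      arrow₁-id : ∀ x → arrow₁ x x ≡ id
      arrow₁-id false = refl
      arrow₁-id true  = refl

      arrow₁-∘ : ∀ x y z → arrow₁ x z ≡ arrow₁ y z ∘ arrow₁ x y
      arrow₁-∘ false false false = sym (identityˡ _)
      arrow₁-∘ false false true  = sym (identityʳ _)
      arrow₁-∘ false true  false = sym (inverseˡ _)
      arrow₁-∘ false true  true  = sym (identityˡ _)
      arrow₁-∘ true  false false = sym (identityˡ _)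
      arrow₁-∘ true  false true  = sym (inverseʳ _)
      arrow₁-∘ true  true  false = sym (identityʳ _)
      arrow₁-∘ true  true  true  = sym (identityˡ _)

module _ {C D : Groupoid} (F : Functor C D) where
  private
    module D = Groupoid D

  const-≡F : ∀ {a a'} → F₀ F a ≡ F₀ F a' → (F ∘F const C a) ≡F (F ∘F const C a')
  const-≡F p = record { eq₀ = λ _ → p ; eq₁ = λ _ → F-id-transport p }
    where
      id-transport : ∀ {x y} (q : x ≡ y) → subst₂ (Hom D) q q D.id ≡ D.id
      id-transport refl = refl
      F-id-transport : ∀ {a a'} (q : F₀ F a ≡ F₀ F a') →
                       subst₂ (Hom D) q q (F₁ F (Groupoid.id C {a})) ≡ F₁ F (Groupoid.id C {a'})
      F-id-transport q = trans (cong (subst₂ (Hom D) q q) (Functor.identity F))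
                           (trans (id-transport q) (sym (Functor.identity F)))

  F-resp-square : ∀ {a b c d} {f : Hom C a b} {k : Hom C b d} {j : Hom C a c} {f' : Hom C c d} →
                  Groupoid._∘_ C k f ≡ Groupoid._∘_ C f' j → F₁ F k D.∘ F₁ F f ≡ F₁ F f' D.∘ F₁ F j
  F-resp-square sq =
    trans (sym (Functor.homomorphism F _ _)) (trans (cong (F₁ F) sq) (Functor.homomorphism F _ _))

  F-∘-≡ : ∀ {a b c d} {f : Hom C a b} {k : Hom C b d} {j : Hom C a c} {f' : Hom C c d}
          {Fk : Hom D (F₀ F b) (F₀ F d)} {Fj : Hom D (F₀ F a) (F₀ F c)} →
          F₁ F k ≡ Fk → F₁ F j ≡ Fj → Fk D.∘ F₁ F f ≡ F₁ F f' D.∘ Fj →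
          F₁ F (Groupoid._∘_ C k f) ≡ F₁ F (Groupoid._∘_ C f' j)
  F-∘-≡ refl refl sq =
    trans (Functor.homomorphism F _ _) (trans sq (sym (Functor.homomorphism F _ _)))

  arrow-≡F : ∀ {a b} {g g' : Hom C a b} → F₁ F g ≡ F₁ F g' → (F ∘F arrow C g) ≡F (F ∘F arrow C g')
  arrow-≡F {g = g} {g'} p = record { eq₀ = λ _ → refl ; eq₁ = λ {x} {y} _ → on-arrow x y }
    where
      on-arrow : ∀ x y → F₁ F (F₁ (arrow C g) {x} {y} tt) ≡ F₁ F (F₁ (arrow C g') {x} {y} tt)
      on-arrow false false = refl
      on-arrow false true  = p
      on-arrow true  false = trans (F-⁻¹ F g) (trans (cong D._⁻¹ p) (sym (F-⁻¹ F g')))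
      on-arrow true  true  = refl

-- The strict pullback property already makes the comparison functor fully
-- faithful: testing it against Point and Interval shows that the projections
-- are jointly injective on objects and on morphisms, and that compatible pairs
-- of morphisms lift.
module StrictPullback {S T B P : Groupoid} (u : Functor S B) (v : Functor T B)
                      (l : Functor P S) (r : Functor P T) (e : (u ∘F l) ≡F (v ∘F r))
                      (pb : IsPullback u v l r) where
  private
    module S = Groupoid S
    module T = Groupoid T
    module B = GroupoidProperties B

  unique : ∀ {X} (h h' : Functor X P) → (l ∘F h) ≡F (l ∘F h') → (r ∘F h) ≡F (r ∘F h') → h ≡F h'
  unique {X} h h' el er =
    ≡F-trans (factor-unique h ≡F-refl ≡F-refl) (≡F-sym (factor-unique h' (≡F-sym el) (≡F-sym er)))
    where
      cone : (u ∘F (l ∘F h)) ≡F (v ∘F (r ∘F h))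
      cone = record { eq₀ = eq₀ (e ▹≡ h) ; eq₁ = eq₁ (e ▹≡ h) }
      factor-unique = proj₂ (proj₂ (proj₂ (pb X (l ∘F h) (r ∘F h) cone)))

  jointly-injective : ∀ {a a'} → F₀ l a ≡ F₀ l a' → F₀ r a ≡ F₀ r a' → a ≡ a'
  jointly-injective {a} {a'} p q =
    eq₀ (unique (const P a) (const P a') (const-≡F l p) (const-≡F r q)) tt

  jointly-faithful : ∀ {a b} {g g' : Hom P a b} → F₁ l g ≡ F₁ l g' → F₁ r g ≡ F₁ r g' → g ≡ g'
  jointly-faithful {g = g} {g'} p q =
    trans (sym (subst₂-loop (Hom P) _ _ g))
          (eq₁ (unique (arrow P g) (arrow P g') (arrow-≡F l p) (arrow-≡F r q)) {false} {true} tt)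

  lift : ∀ {a b} (x : Hom S (F₀ l a) (F₀ l b)) (y : Hom T (F₀ r a) (F₀ r b)) →
         B.≡⇒Hom (eq₀ e b) B.∘ F₁ u x ≡ F₁ v y B.∘ B.≡⇒Hom (eq₀ e a) →
         Σ[ g ∈ Hom P a b ] (F₁ l g ≡ x × F₁ r g ≡ y)
  lift {a} {b} x y square = g , F₁-g l l-H , F₁-g r r-H
    where
      square-id : ∀ {z} → B.≡⇒Hom (eq₀ e z) B.∘ F₁ u (S.id {F₀ l z})
                          ≡ F₁ v (T.id {F₀ r z}) B.∘ B.≡⇒Hom (eq₀ e z)
      square-id {z} = begin
        B.≡⇒Hom (eq₀ e z) B.∘ F₁ u S.id   ≡⟨ cong (B.≡⇒Hom (eq₀ e z) B.∘_) (Functor.identity u) ⟩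
        B.≡⇒Hom (eq₀ e z) B.∘ B.id        ≡⟨ B.identityʳ _ ⟩
        B.≡⇒Hom (eq₀ e z)                 ≡⟨ sym (B.identityˡ _) ⟩
        B.id B.∘ B.≡⇒Hom (eq₀ e z)        ≡⟨ cong (B._∘ B.≡⇒Hom (eq₀ e z)) (sym (Functor.identity v)) ⟩
        F₁ v T.id B.∘ B.≡⇒Hom (eq₀ e z)   ∎
        where open ≡-Reasoning
      square⁻¹ : B.≡⇒Hom (eq₀ e a) B.∘ F₁ u (x S.⁻¹) ≡ F₁ v (y T.⁻¹) B.∘ B.≡⇒Hom (eq₀ e b)
      square⁻¹ = trans (cong (B.≡⇒Hom (eq₀ e a) B.∘_) (F-⁻¹ u x))
                   (trans (B.flipʰ square) (cong (B._∘ B.≡⇒Hom (eq₀ e b)) (sym (F-⁻¹ v y))))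
      cone : (u ∘F arrow S x) ≡F (v ∘F arrow T y)
      cone = record
        { eq₀ = λ { false → eq₀ e a ; true → eq₀ e b }
        ; eq₁ = λ { {false} {false} _ → B.subst₂-≡⇒Hom _ _ square-id
                  ; {false} {true}  _ → B.subst₂-≡⇒Hom _ _ square
                  ; {true}  {false} _ → B.subst₂-≡⇒Hom _ _ square⁻¹
                  ; {true}  {true}  _ → B.subst₂-≡⇒Hom _ _ square-id } }
      factorisation = pb Interval (arrow S x) (arrow T y) cone
      H = proj₁ factorisation
      l-H = proj₁ (proj₂ factorisation)
      r-H = proj₁ (proj₂ (proj₂ factorisation))
      H-false : F₀ H false ≡ a
      H-false = jointly-injective (eq₀ l-H false) (eq₀ r-H false)
      H-true : F₀ H true ≡ b
      H-true = jointly-injective (eq₀ l-H true) (eq₀ r-H true)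
      g : Hom P a b
      g = subst₂ (Hom P) H-false H-true (F₁ H {false} {true} tt)
      F₁-g : ∀ {C} (k : Functor P C) {z : Hom C (F₀ k a) (F₀ k b)} → (k ∘F H) ≡F arrow C z → F₁ k g ≡ z
      F₁-g {C} k {z} kH = begin
        F₁ k g
          ≡⟨ F-subst₂ k H-false H-true _ ⟩
        subst₂ (Hom C) (cong (F₀ k) H-false) (cong (F₀ k) H-true) (F₁ k (F₁ H {false} {true} tt))
          ≡⟨ cong₂ (λ p q → subst₂ (Hom C) p q (F₁ k (F₁ H {false} {true} tt))) (uip _ _) (uip _ _) ⟩
        subst₂ (Hom C) (eq₀ kH false) (eq₀ kH true) (F₁ k (F₁ H {false} {true} tt))
          ≡⟨ eq₁ kH {false} {true} tt ⟩
        z ∎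
        where open ≡-Reasoning

  comparison-full : ∀ X → Full (Compare u v l r (≡F⇒NatTrans e) X)
  comparison-full X {h} {h'} m = θ , (λ x → proj₁ (proj₂ (L x))) , (λ x → proj₂ (proj₂ (L x)))
    where
      L = λ x → lift (η (α m) x) (η (β m) x) (cond m x)
      θ : NatTrans h h'
      θ = record
        { η = λ x → proj₁ (L x)
        ; commute = λ {x} {y} f → jointly-faithful
            (F-∘-≡ l (proj₁ (proj₂ (L y))) (proj₁ (proj₂ (L x))) (commute (α m) f))
            (F-∘-≡ r (proj₂ (proj₂ (L y))) (proj₂ (proj₂ (L x))) (commute (β m) f))
        }

whiskerˡ : ∀ {X C D} (F : Functor C D) {G H : Functor X C} → NatTrans G H → NatTrans (F ∘F G) (F ∘F H)
whiskerˡ F θ = record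
  { η = λ x → F₁ F (η θ x)
  ; commute = λ f → F-resp-square F (commute θ f) }

whiskerʳ : ∀ {X C D} {G H : Functor C D} → NatTrans G H → (K : Functor X C) → NatTrans (G ∘F K) (H ∘F K)
whiskerʳ θ K = record { η = λ x → η θ (F₀ K x) ; commute = λ f → commute θ (F₁ K f) }

inverseNT : ∀ {C D} {F G : Functor C D} → NatTrans F G → NatTrans G F
inverseNT {D = D} θ = record
  { η = λ x → η θ x D.⁻¹
  ; commute = λ f → D.flipᵛ (commute θ f) }
  where module D = GroupoidProperties D

Reaches : ∀ {C D} (F : CFunctor C D) → Category.Ob D → Set
Reaches {C} {D} F d = Σ[ h ∈ Category.Ob C ] Category._⇒_ D (CFunctor.F₀ F h) d

module _ {S T B : Groupoid} {u : Functor S B} {v : Functor T B} {X : Groupoid} where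
  private
    module B = GroupoidProperties B
    module S = Groupoid S
    module T = Groupoid T

  inversePC : ∀ {c d : Pseudocone u v X} → PCMor c d → PCMor d c
  inversePC {c} {d} m = record
    { α = inverseNT (α m) ; β = inverseNT (β m)
    ; cond = λ x → trans (cong (η (ν c) x B.∘_) (F-⁻¹ u (η (α m) x)))
               (trans (sym (B.flipᵛ (sym (cond m x))))
                 (cong (B._∘ η (ν d) x) (sym (F-⁻¹ v (η (β m) x))))) }

  -- Every morphism of pseudocones is invertible, so it suffices to reach each
  -- pseudocone by some morphism.
  essSurj-from-morphisms : ∀ {P} (l : Functor P S) (r : Functor P T) (μ : NatTrans (u ∘F l) (v ∘F r)) →
    (∀ d → Reaches (Compare u v l r μ X) d) → EssSurj (Compare u v l r μ X)
  essSurj-from-morphisms l r μ reach d = proj₁ (reach d) , record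
    { from = proj₂ (reach d) ; to = inversePC (proj₂ (reach d))
    ; isoˡ = (λ x → S.inverseˡ _) , (λ x → T.inverseˡ _)
    ; isoʳ = (λ x → S.inverseʳ _) , (λ x → T.inverseʳ _) }

π₁F : ∀ {C D} → Functor (C ×G D) C
π₁F = record { F₀ = proj₁ ; F₁ = proj₁ ; identity = refl ; homomorphism = λ _ _ → refl }

π₂F : ∀ {C D} → Functor (C ×G D) D
π₂F = record { F₀ = proj₂ ; F₁ = proj₂ ; identity = refl ; homomorphism = λ _ _ → refl }

module Pasting
  {L A M B R P Q S : Groupoid}
  (fLA : Functor L A) (fMA : Functor M A) (fMB : Functor M B) (fRB : Functor R B)
  (plPL : Functor P L) (prPM : Functor P M)
  (sq1 : (fLA ∘F plPL) ≡F (fMA ∘F prPM))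
  (plQM : Functor Q M) (prQR : Functor Q R)
  (sq3 : (fMB ∘F plQM) ≡F (fRB ∘F prQR))
  (plSP : Functor S P) (prSQ : Functor S Q)
  (sq2 : (prPM ∘F plSP) ≡F (plQM ∘F prSQ))
  where
  open Squares fLA fMA fMB fRB plPL prPM sq1 plQM prQR sq3 plSP prSQ sq2

  pullback4 : IsPullback fLA fMA plPL prPM → IsPullback fMB fRB plQM prQR →
              IsPullback prPM plQM plSP prSQ →
              IsPullback ⟨ fMA , fMB ⟩F (fLA ×F fRB) (prPM ∘F plSP) ⟨ plPL ∘F plSP , prQR ∘F prSQ ⟩F
  pullback4 pb1 pb3 pb2 X m b e = s , m-factors , b-factors , unique
    where
      -- F ∘F (G ∘F H) and (F ∘F G) ∘F H agree only up to their proof fields, so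
      -- equalities and transformations between them are re-packed as records.
      eA : (fLA ∘F (π₁F ∘F b)) ≡F (fMA ∘F m)
      eA = let z = ≡F-sym (π₁F ◃≡ e) in record { eq₀ = eq₀ z ; eq₁ = eq₁ z }
      eB : (fMB ∘F m) ≡F (fRB ∘F (π₂F ∘F b))
      eB = let z = π₂F ◃≡ e in record { eq₀ = eq₀ z ; eq₁ = eq₁ z }
      p-factorisation = pb1 X (π₁F ∘F b) m eA
      q-factorisation = pb3 X m (π₂F ∘F b) eB
      p = proj₁ p-factorisation
      q = proj₁ q-factorisation
      plPL-p = proj₁ (proj₂ p-factorisation)
      prPM-p = proj₁ (proj₂ (proj₂ p-factorisation))
      p-unique = proj₂ (proj₂ (proj₂ p-factorisation))
      plQM-q = proj₁ (proj₂ q-factorisation)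
      prQR-q = proj₁ (proj₂ (proj₂ q-factorisation))
      q-unique = proj₂ (proj₂ (proj₂ q-factorisation))
      s-factorisation = pb2 X p q (≡F-trans prPM-p (≡F-sym plQM-q))
      s = proj₁ s-factorisation
      plSP-s = proj₁ (proj₂ s-factorisation)
      prSQ-s = proj₁ (proj₂ (proj₂ s-factorisation))
      s-unique = proj₂ (proj₂ (proj₂ s-factorisation))

      m-factors : ((prPM ∘F plSP) ∘F s) ≡F m
      m-factors = let z = ≡F-trans (prPM ◃≡ plSP-s) prPM-p in record { eq₀ = eq₀ z ; eq₁ = eq₁ z }

      b-factors : (⟨ plPL ∘F plSP , prQR ∘F prSQ ⟩F ∘F s) ≡F b
      b-factors =
        let z = ⟨ ≡F-trans (plPL ◃≡ plSP-s) plPL-p , ≡F-trans (prQR ◃≡ prSQ-s) prQR-q ⟩≡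
        in record { eq₀ = eq₀ z ; eq₁ = eq₁ z }

      unique : ∀ h → ((prPM ∘F plSP) ∘F h) ≡F m → (⟨ plPL ∘F plSP , prQR ∘F prSQ ⟩F ∘F h) ≡F b → h ≡F s
      unique h eM eLR = s-unique h (p-unique (plSP ∘F h) eL eM′) (q-unique (prSQ ∘F h) eM″ eR)
        where
          eL : (plPL ∘F (plSP ∘F h)) ≡F (π₁F ∘F b)
          eL = let z = π₁F ◃≡ eLR in record { eq₀ = eq₀ z ; eq₁ = eq₁ z }
          eR : (prQR ∘F (prSQ ∘F h)) ≡F (π₂F ∘F b)
          eR = let z = π₂F ◃≡ eLR in record { eq₀ = eq₀ z ; eq₁ = eq₁ z }
          eM′ : (prPM ∘F (plSP ∘F h)) ≡F m
          eM′ = record { eq₀ = eq₀ eM ; eq₁ = eq₁ eM }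
          eM″ : (plQM ∘F (prSQ ∘F h)) ≡F m
          eM″ = let z = ≡F-trans (≡F-sym (sq2 ▹≡ h)) eM in record { eq₀ = eq₀ z ; eq₁ = eq₁ z }

  private
    module A = GroupoidProperties A
    module B = GroupoidProperties B
    module M = GroupoidProperties M
    module AB = Groupoid (A ×G B)

  μ1 : ∀ x → Hom A (F₀ fLA (F₀ plPL x)) (F₀ fMA (F₀ prPM x))
  μ1 x = A.≡⇒Hom (eq₀ sq1 x)

  μ2 : ∀ x → Hom M (F₀ prPM (F₀ plSP x)) (F₀ plQM (F₀ prSQ x))
  μ2 x = M.≡⇒Hom (eq₀ sq2 x)

  μ3 : ∀ x → Hom B (F₀ fMB (F₀ plQM x)) (F₀ fRB (F₀ prQR x))
  μ3 x = B.≡⇒Hom (eq₀ sq3 x)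

  μ12 : ∀ x → Hom A (F₀ fLA (F₀ plPL (F₀ plSP x))) (F₀ fMA (F₀ plQM (F₀ prSQ x)))
  μ12 x = A.≡⇒Hom (eq₀ comm12 x)

  μ23 : ∀ x → Hom B (F₀ fMB (F₀ prPM (F₀ plSP x))) (F₀ fRB (F₀ prQR (F₀ prSQ x)))
  μ23 x = B.≡⇒Hom (eq₀ comm23 x)

  μ4 : ∀ x → Hom (A ×G B) (F₀ fMA (F₀ prPM (F₀ plSP x)) , F₀ fMB (F₀ prPM (F₀ plSP x)))
                          (F₀ fLA (F₀ plPL (F₀ plSP x)) , F₀ fRB (F₀ prQR (F₀ prSQ x)))
  μ4 x = GroupoidProperties.≡⇒Hom (A ×G B) (eq₀ comm4 x)

  μ12-pasting : ∀ x → μ12 x ≡ F₁ fMA (μ2 x) A.∘ μ1 (F₀ plSP x)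
  μ12-pasting x = begin
    μ12 x
      ≡⟨ A.≡⇒Hom-irrelevant _ _ ⟩
    A.≡⇒Hom (trans (eq₀ sq1 (F₀ plSP x)) (cong (F₀ fMA) (eq₀ sq2 x)))
      ≡⟨ A.≡⇒Hom-trans _ _ ⟩
    A.≡⇒Hom (cong (F₀ fMA) (eq₀ sq2 x)) A.∘ μ1 (F₀ plSP x)
      ≡⟨ cong (A._∘ μ1 (F₀ plSP x)) (sym (F-≡⇒Hom fMA (eq₀ sq2 x))) ⟩
    F₁ fMA (μ2 x) A.∘ μ1 (F₀ plSP x) ∎
    where open ≡-Reasoning

  μ23-pasting : ∀ x → μ23 x ≡ μ3 (F₀ prSQ x) B.∘ F₁ fMB (μ2 x)
  μ23-pasting x = begin
    μ23 x
      ≡⟨ B.≡⇒Hom-irrelevant _ _ ⟩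
    B.≡⇒Hom (trans (cong (F₀ fMB) (eq₀ sq2 x)) (eq₀ sq3 (F₀ prSQ x)))
      ≡⟨ B.≡⇒Hom-trans _ _ ⟩
    μ3 (F₀ prSQ x) B.∘ B.≡⇒Hom (cong (F₀ fMB) (eq₀ sq2 x))
      ≡⟨ cong (μ3 (F₀ prSQ x) B.∘_) (sym (F-≡⇒Hom fMB (eq₀ sq2 x))) ⟩
    μ3 (F₀ prSQ x) B.∘ F₁ fMB (μ2 x) ∎
    where open ≡-Reasoning

  μ4-components : ∀ x → μ4 x ≡ (μ1 (F₀ plSP x) A.⁻¹ , μ23 x)
  μ4-components x = begin
    μ4 x
      ≡⟨ GroupoidProperties.≡⇒Hom-irrelevant (A ×G B) _ (cong₂ _,_ (sym (eq₀ sq1 (F₀ plSP x))) (eq₀ comm23 x)) ⟩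
    GroupoidProperties.≡⇒Hom (A ×G B) (cong₂ _,_ (sym (eq₀ sq1 (F₀ plSP x))) (eq₀ comm23 x))
      ≡⟨ ≡⇒Hom-pair {C = A} {D = B} (sym (eq₀ sq1 (F₀ plSP x))) (eq₀ comm23 x) ⟩
    (A.≡⇒Hom (sym (eq₀ sq1 (F₀ plSP x))) , μ23 x)
      ≡⟨ cong (_, μ23 x) (A.≡⇒Hom-sym _) ⟩
    (μ1 (F₀ plSP x) A.⁻¹ , μ23 x) ∎
    where open ≡-Reasoning

  nat1 : ∀ {x y} (g : Hom P x y) → μ1 y A.∘ F₁ fLA (F₁ plPL g) ≡ F₁ fMA (F₁ prPM g) A.∘ μ1 x
  nat1 = commute (≡F⇒NatTrans sq1)

  nat2 : ∀ {x y} (g : Hom S x y) → μ2 y M.∘ F₁ prPM (F₁ plSP g) ≡ F₁ plQM (F₁ prSQ g) M.∘ μ2 x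
  nat2 = commute (≡F⇒NatTrans sq2)

  nat3 : ∀ {x y} (g : Hom Q x y) → μ3 y B.∘ F₁ fMB (F₁ plQM g) ≡ F₁ fRB (F₁ prQR g) B.∘ μ3 x
  nat3 = commute (≡F⇒NatTrans sq3)

  square4-split : ∀ {x a₀ b₀} {N : Hom (A ×G B) a₀ b₀} {n₁ n₂ a b c d} → N ≡ (n₁ , n₂) →
                  N AB.∘ (a , b) ≡ (c , d) AB.∘ μ4 x →
                  (n₁ A.∘ a ≡ c A.∘ (μ1 (F₀ plSP x) A.⁻¹)) × (n₂ B.∘ b ≡ d B.∘ μ23 x)
  square4-split {x} {c = c} {d} refl e =
    let e' = trans e (cong ((c , d) AB.∘_) (μ4-components x)) in cong proj₁ e' , cong proj₂ e'

  square4-join : ∀ {x a₀ b₀} {N : Hom (A ×G B) a₀ b₀} {n₁ n₂ a b c d} → N ≡ (n₁ , n₂) →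
                 n₁ A.∘ a ≡ c A.∘ (μ1 (F₀ plSP x) A.⁻¹) → n₂ B.∘ b ≡ d B.∘ μ23 x →
                 N AB.∘ (a , b) ≡ (c , d) AB.∘ μ4 x
  square4-join {x} {c = c} {d} refl eA eB =
    trans (cong₂ _,_ eA eB) (sym (cong ((c , d) AB.∘_) (μ4-components x)))

  module Comparisons (X : Groupoid) where
    Cmp1 : CFunctor (FunCat X P) (PCCat fLA fMA X)
    Cmp1 = Compare fLA fMA plPL prPM (≡F⇒NatTrans sq1) X

    Cmp3 : CFunctor (FunCat X Q) (PCCat fMB fRB X)
    Cmp3 = Compare fMB fRB plQM prQR (≡F⇒NatTrans sq3) X

    Cmp12 : CFunctor (FunCat X S) (PCCat fLA (fMA ∘F plQM) X)
    Cmp12 = Compare fLA (fMA ∘F plQM) (plPL ∘F plSP) prSQ (≡F⇒NatTrans comm12) X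

    Cmp23 : CFunctor (FunCat X S) (PCCat (fMB ∘F prPM) fRB X)
    Cmp23 = Compare (fMB ∘F prPM) fRB plSP (prQR ∘F prSQ) (≡F⇒NatTrans comm23) X

    Cmp4 : CFunctor (FunCat X S) (PCCat ⟨ fMA , fMB ⟩F (fLA ×F fRB) X)
    Cmp4 = Compare ⟨ fMA , fMB ⟩F (fLA ×F fRB) (prPM ∘F plSP) ⟨ plPL ∘F plSP , prQR ∘F prSQ ⟩F
                   (≡F⇒NatTrans comm4) X

    reach4⇒essSurj : (∀ d → Reaches Cmp4 d) → EssSurj Cmp4
    reach4⇒essSurj = essSurj-from-morphisms (prPM ∘F plSP) ⟨ plPL ∘F plSP , prQR ∘F prSQ ⟩F (≡F⇒NatTrans comm4)

    module Halves (d : Pseudocone ⟨ fMA , fMB ⟩F (fLA ×F fRB) X) where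
      νA : NatTrans (fMA ∘F l' d) (fLA ∘F (π₁F ∘F r' d))
      νA = record { η = λ x → proj₁ (η (ν d) x) ; commute = λ f → cong proj₁ (commute (ν d) f) }

      νB : NatTrans (fMB ∘F l' d) (fRB ∘F (π₂F ∘F r' d))
      νB = record { η = λ x → proj₂ (η (ν d) x) ; commute = λ f → cong proj₂ (commute (ν d) f) }

    essSurj-i : EssSurj Cmp1 → EssSurj Cmp23 → EssSurj Cmp4
    essSurj-i es1 es23 = reach4⇒essSurj reach
      where
        reach : ∀ d → Reaches Cmp4 d
        reach d = s , record
          { α = record { η = η αt ; commute = commute αt }
          ; β = record { η = λ x → η βL x , η (β i23) x
                       ; commute = λ f → cong₂ _,_ (commute βL f) (commute (β i23) f) }
          ; cond = λ x → square4-join refl (A-square x) (B-square x) }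
          where
            open Halves d
            c1 : Pseudocone fLA fMA X
            c1 = record { l' = π₁F ∘F r' d ; r' = l' d ; ν = inverseNT νA }
            p : Functor X P
            p = proj₁ (es1 c1)
            i1 : PCMor (CFunctor.F₀ Cmp1 p) c1
            i1 = Iso.from (proj₂ (es1 c1))
            c23 : Pseudocone (fMB ∘F prPM) fRB X
            c23 = record { l' = p ; r' = π₂F ∘F r' d
                         ; ν = let t = νB ∘V whiskerˡ fMB (β i1) in record { η = η t ; commute = commute t } }
            s : Functor X S
            s = proj₁ (es23 c23)
            i23 : PCMor (CFunctor.F₀ Cmp23 s) c23
            i23 = Iso.from (proj₂ (es23 c23))
            αt : NatTrans (prPM ∘F (plSP ∘F s)) (l' d)
            αt = β i1 ∘V whiskerˡ prPM (α i23)
            βL : NatTrans (plPL ∘F (plSP ∘F s)) (π₁F ∘F r' d)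
            βL = α i1 ∘V whiskerˡ plPL (α i23)
            A-square : ∀ x → proj₁ (η (ν d) x) A.∘ F₁ fMA (η αt x)
                             ≡ F₁ fLA (η βL x) A.∘ (μ1 (F₀ plSP (F₀ s x)) A.⁻¹)
            A-square x = begin
              proj₁ (η (ν d) x) A.∘ F₁ fMA (η αt x)
                ≡⟨ cong (_ A.∘_) (Functor.homomorphism fMA _ _) ⟩
              proj₁ (η (ν d) x) A.∘ (F₁ fMA (η (β i1) x) A.∘ F₁ fMA (F₁ prPM (η (α i23) x)))
                ≡⟨ A.flipᵛ-⁻¹ (A.glue (cond i1 x) (nat1 (η (α i23) x))) ⟩
              (F₁ fLA (η (α i1) x) A.∘ F₁ fLA (F₁ plPL (η (α i23) x))) A.∘ (μ1 (F₀ plSP (F₀ s x)) A.⁻¹)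
                ≡⟨ cong (A._∘ (μ1 (F₀ plSP (F₀ s x)) A.⁻¹)) (sym (Functor.homomorphism fLA _ _)) ⟩
              F₁ fLA (η βL x) A.∘ (μ1 (F₀ plSP (F₀ s x)) A.⁻¹) ∎
              where open ≡-Reasoning
            B-square : ∀ x → proj₂ (η (ν d) x) B.∘ F₁ fMB (η αt x) ≡ F₁ fRB (η (β i23) x) B.∘ μ23 (F₀ s x)
            B-square x = trans (cong (_ B.∘_) (Functor.homomorphism fMB _ _))
                               (trans (sym (B.assoc _ _ _)) (cond i23 x))

    full-i : Full Cmp1 → Full Cmp23 → Full Cmp4
    full-i full1 full23 {s} {s'} m =
      θ , (λ x → trans (cong (F₁ prPM) (proj₁ e23 x)) (proj₂ e1 x))
        , (λ x → cong₂ _,_ (trans (cong (F₁ plPL) (proj₁ e23 x)) (proj₁ e1 x)) (proj₂ e23 x))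
      where
        squares = λ x → square4-split (μ4-components (F₀ s' x)) (cond m x)
        m1 : PCMor (CFunctor.F₀ Cmp1 (plSP ∘F s)) (CFunctor.F₀ Cmp1 (plSP ∘F s'))
        m1 = record
          { α = record { η = λ x → proj₁ (η (β m) x) ; commute = λ f → cong proj₁ (commute (β m) f) }
          ; β = record { η = η (α m) ; commute = commute (α m) }
          ; cond = λ x → A.unflipᵛ (proj₁ (squares x)) }
        θ1 : NatTrans (plSP ∘F s) (plSP ∘F s')
        θ1 = proj₁ (full1 m1)
        e1 = proj₂ (full1 m1)
        m23 : PCMor (CFunctor.F₀ Cmp23 s) (CFunctor.F₀ Cmp23 s')
        m23 = record
          { α = θ1
          ; β = record { η = λ x → proj₂ (η (β m) x) ; commute = λ f → cong proj₂ (commute (β m) f) }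
          ; cond = λ x → trans (cong (λ g → μ23 (F₀ s' x) B.∘ F₁ fMB g) (proj₂ e1 x)) (proj₂ (squares x)) }
        θ : NatTrans s s'
        θ = proj₁ (full23 m23)
        e23 = proj₂ (full23 m23)

    faithful-i : Faithful Cmp1 → Faithful Cmp23 → Faithful Cmp4
    faithful-i faithful1 faithful23 θ θ' (eM , eLR) =
      faithful23 θ θ' (plSP-θ , λ x → cong proj₂ (eLR x))
      where
        plSP-θ = faithful1 (whiskerˡ plSP θ) (whiskerˡ plSP θ') ((λ x → cong proj₁ (eLR x)) , eM)

    μ2NT : (s : Functor X S) → NatTrans ((prPM ∘F plSP) ∘F s) (plQM ∘F (prSQ ∘F s))
    μ2NT s = let t = whiskerʳ (≡F⇒NatTrans sq2) s in record { η = η t ; commute = commute t }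

    μ12-absorb : ∀ {x y} (g : Hom Q (F₀ prSQ x) y) →
                 F₁ fMA (F₁ plQM g) A.∘ μ12 x ≡ F₁ fMA (F₁ plQM g M.∘ μ2 x) A.∘ μ1 (F₀ plSP x)
    μ12-absorb {x} g = begin
      F₁ fMA (F₁ plQM g) A.∘ μ12 x
        ≡⟨ cong (_ A.∘_) (μ12-pasting x) ⟩
      F₁ fMA (F₁ plQM g) A.∘ (F₁ fMA (μ2 x) A.∘ μ1 (F₀ plSP x))
        ≡⟨ sym (A.assoc _ _ _) ⟩
      (F₁ fMA (F₁ plQM g) A.∘ F₁ fMA (μ2 x)) A.∘ μ1 (F₀ plSP x)
        ≡⟨ cong (A._∘ μ1 (F₀ plSP x)) (sym (Functor.homomorphism fMA _ _)) ⟩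
      F₁ fMA (F₁ plQM g M.∘ μ2 x) A.∘ μ1 (F₀ plSP x) ∎
      where open ≡-Reasoning

    essSurj-ii : EssSurj Cmp3 → EssSurj Cmp12 → EssSurj Cmp4
    essSurj-ii es3 es12 = reach4⇒essSurj reach
      where
        reach : ∀ d → Reaches Cmp4 d
        reach d = s , record
          { α = record { η = η αt ; commute = commute αt }
          ; β = record { η = λ x → η (α i12) x , η βR x
                       ; commute = λ f → cong₂ _,_ (commute (α i12) f) (commute βR f) }
          ; cond = λ x → square4-join refl (A-square x) (B-square x) }
          where
            open Halves d
            c3 : Pseudocone fMB fRB X
            c3 = record { l' = l' d ; r' = π₂F ∘F r' d ; ν = νB }
            q : Functor X Q
            q = proj₁ (es3 c3)
            i3 : PCMor (CFunctor.F₀ Cmp3 q) c3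
            i3 = Iso.from (proj₂ (es3 c3))
            c12 : Pseudocone fLA (fMA ∘F plQM) X
            c12 = record { l' = π₁F ∘F r' d ; r' = q
                         ; ν = let t = inverseNT (νA ∘V whiskerˡ fMA (α i3))
                               in record { η = η t ; commute = commute t } }
            s : Functor X S
            s = proj₁ (es12 c12)
            i12 : PCMor (CFunctor.F₀ Cmp12 s) c12
            i12 = Iso.from (proj₂ (es12 c12))
            αt : NatTrans ((prPM ∘F plSP) ∘F s) (l' d)
            αt = α i3 ∘V (whiskerˡ plQM (β i12) ∘V μ2NT s)
            βR : NatTrans (prQR ∘F (prSQ ∘F s)) (π₂F ∘F r' d)
            βR = β i3 ∘V whiskerˡ prQR (β i12)
            A-square : ∀ x → proj₁ (η (ν d) x) A.∘ F₁ fMA (η αt x)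
                             ≡ F₁ fLA (η (α i12) x) A.∘ (μ1 (F₀ plSP (F₀ s x)) A.⁻¹)
            A-square x = begin
              proj₁ (η (ν d) x) A.∘ F₁ fMA (η αt x)
                ≡⟨ cong (_ A.∘_) (Functor.homomorphism fMA _ _) ⟩
              proj₁ (η (ν d) x) A.∘ (F₁ fMA (η (α i3) x) A.∘ F₁ fMA (F₁ plQM (η (β i12) x) M.∘ μ2 (F₀ s x)))
                ≡⟨ sym (A.assoc _ _ _) ⟩
              (proj₁ (η (ν d) x) A.∘ F₁ fMA (η (α i3) x)) A.∘ F₁ fMA (F₁ plQM (η (β i12) x) M.∘ μ2 (F₀ s x))
                ≡⟨ A.flipᵛ-⁻¹ (trans (cond i12 x) (μ12-absorb (η (β i12) x))) ⟩
              F₁ fLA (η (α i12) x) A.∘ (μ1 (F₀ plSP (F₀ s x)) A.⁻¹) ∎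
              where open ≡-Reasoning
            B-square : ∀ x → proj₂ (η (ν d) x) B.∘ F₁ fMB (η αt x) ≡ F₁ fRB (η βR x) B.∘ μ23 (F₀ s x)
            B-square x = begin
              νB.η x B.∘ F₁ fMB (α3 M.∘ (plQM-β12 M.∘ μ2 (F₀ s x)))
                ≡⟨ cong (νB.η x B.∘_) (trans (Functor.homomorphism fMB _ _)
                                        (cong (F₁ fMB α3 B.∘_) (Functor.homomorphism fMB _ _))) ⟩
              νB.η x B.∘ (F₁ fMB α3 B.∘ (F₁ fMB plQM-β12 B.∘ F₁ fMB (μ2 (F₀ s x))))
                ≡⟨ cong (νB.η x B.∘_) (sym (B.assoc _ _ _)) ⟩
              νB.η x B.∘ ((F₁ fMB α3 B.∘ F₁ fMB plQM-β12) B.∘ F₁ fMB (μ2 (F₀ s x)))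
                ≡⟨ sym (B.assoc _ _ _) ⟩
              (νB.η x B.∘ (F₁ fMB α3 B.∘ F₁ fMB plQM-β12)) B.∘ F₁ fMB (μ2 (F₀ s x))
                ≡⟨ cong (B._∘ F₁ fMB (μ2 (F₀ s x))) (B.glue (cond i3 x) (nat3 (η (β i12) x))) ⟩
              ((F₁ fRB (η (β i3) x) B.∘ F₁ fRB (F₁ prQR (η (β i12) x))) B.∘ μ3 (F₀ prSQ (F₀ s x)))
                B.∘ F₁ fMB (μ2 (F₀ s x))
                ≡⟨ B.assoc _ _ _ ⟩
              (F₁ fRB (η (β i3) x) B.∘ F₁ fRB (F₁ prQR (η (β i12) x))) B.∘ (μ3 (F₀ prSQ (F₀ s x))
                B.∘ F₁ fMB (μ2 (F₀ s x)))
                ≡⟨ cong₂ B._∘_ (sym (Functor.homomorphism fRB _ _)) (sym (μ23-pasting (F₀ s x))) ⟩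
              F₁ fRB (η βR x) B.∘ μ23 (F₀ s x) ∎
              where
                open ≡-Reasoning
                module νB = NatTrans νB
                α3 = η (α i3) x
                plQM-β12 = F₁ plQM (η (β i12) x)

    full-ii : Full Cmp3 → Full Cmp12 → Full Cmp4
    full-ii full3 full12 {s} {s'} m =
      θ , (λ x → M.monic (trans (nat2 (η θ x))
                   (trans (cong (λ g → F₁ plQM g M.∘ μ2 (F₀ s x)) (proj₂ e12 x)) (plQM-θ3 x))))
        , (λ x → cong₂ _,_ (proj₁ e12 x) (trans (cong (F₁ prQR) (proj₂ e12 x)) (proj₂ e3 x)))
      where
        squares = λ x → square4-split (μ4-components (F₀ s' x)) (cond m x)
        a = η (α m)
        αt : NatTrans (plQM ∘F (prSQ ∘F s)) (plQM ∘F (prSQ ∘F s'))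
        αt = let t = μ2NT s' ∘V (α m ∘V inverseNT (μ2NT s)) in record { η = η t ; commute = commute t }
        conjugate-μ2 : ∀ x → η αt x M.∘ μ2 (F₀ s x) ≡ μ2 (F₀ s' x) M.∘ a x
        conjugate-μ2 x = trans (M.assoc _ _ _) (cong (μ2 (F₀ s' x) M.∘_) (M.cancelʳ (M.inverseˡ _)))
        m3 : PCMor (CFunctor.F₀ Cmp3 (prSQ ∘F s)) (CFunctor.F₀ Cmp3 (prSQ ∘F s'))
        m3 = record
          { α = αt
          ; β = record { η = λ x → proj₂ (η (β m) x) ; commute = λ f → cong proj₂ (commute (β m) f) }
          ; cond = B-square }
          where
            B-square : ∀ x → μ3 (F₀ prSQ (F₀ s' x)) B.∘ F₁ fMB (η αt x)
                             ≡ F₁ fRB (proj₂ (η (β m) x)) B.∘ μ3 (F₀ prSQ (F₀ s x))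
            B-square x = B.epic (begin
              (μ3 (F₀ prSQ (F₀ s' x)) B.∘ F₁ fMB (η αt x)) B.∘ F₁ fMB (μ2 (F₀ s x))
                ≡⟨ B.assoc _ _ _ ⟩
              μ3 (F₀ prSQ (F₀ s' x)) B.∘ (F₁ fMB (η αt x) B.∘ F₁ fMB (μ2 (F₀ s x)))
                ≡⟨ cong (μ3 (F₀ prSQ (F₀ s' x)) B.∘_)
                        (F-resp-square fMB (conjugate-μ2 x)) ⟩
              μ3 (F₀ prSQ (F₀ s' x)) B.∘ (F₁ fMB (μ2 (F₀ s' x)) B.∘ F₁ fMB (a x))
                ≡⟨ sym (B.assoc _ _ _) ⟩
              (μ3 (F₀ prSQ (F₀ s' x)) B.∘ F₁ fMB (μ2 (F₀ s' x))) B.∘ F₁ fMB (a x)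
                ≡⟨ cong (B._∘ F₁ fMB (a x)) (sym (μ23-pasting (F₀ s' x))) ⟩
              μ23 (F₀ s' x) B.∘ F₁ fMB (a x)
                ≡⟨ proj₂ (squares x) ⟩
              F₁ fRB (proj₂ (η (β m) x)) B.∘ μ23 (F₀ s x)
                ≡⟨ cong (F₁ fRB (proj₂ (η (β m) x)) B.∘_) (μ23-pasting (F₀ s x)) ⟩
              F₁ fRB (proj₂ (η (β m) x)) B.∘ (μ3 (F₀ prSQ (F₀ s x)) B.∘ F₁ fMB (μ2 (F₀ s x)))
                ≡⟨ sym (B.assoc _ _ _) ⟩
              (F₁ fRB (proj₂ (η (β m) x)) B.∘ μ3 (F₀ prSQ (F₀ s x))) B.∘ F₁ fMB (μ2 (F₀ s x)) ∎)
              where open ≡-Reasoning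
        θ3 : NatTrans (prSQ ∘F s) (prSQ ∘F s')
        θ3 = proj₁ (full3 m3)
        e3 = proj₂ (full3 m3)
        plQM-θ3 : ∀ x → F₁ plQM (η θ3 x) M.∘ μ2 (F₀ s x) ≡ μ2 (F₀ s' x) M.∘ a x
        plQM-θ3 x = trans (cong (M._∘ μ2 (F₀ s x)) (proj₁ e3 x)) (conjugate-μ2 x)
        m12 : PCMor (CFunctor.F₀ Cmp12 s) (CFunctor.F₀ Cmp12 s')
        m12 = record
          { α = record { η = λ x → proj₁ (η (β m) x) ; commute = λ f → cong proj₁ (commute (β m) f) }
          ; β = θ3
          ; cond = A-square }
          where
            A-square : ∀ x → μ12 (F₀ s' x) A.∘ F₁ fLA (proj₁ (η (β m) x))
                             ≡ F₁ fMA (F₁ plQM (η θ3 x)) A.∘ μ12 (F₀ s x)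
            A-square x = begin
              μ12 (F₀ s' x) A.∘ F₁ fLA (proj₁ (η (β m) x))
                ≡⟨ cong (A._∘ _) (μ12-pasting (F₀ s' x)) ⟩
              (F₁ fMA (μ2 (F₀ s' x)) A.∘ μ1 (F₀ plSP (F₀ s' x))) A.∘ F₁ fLA (proj₁ (η (β m) x))
                ≡⟨ A.assoc _ _ _ ⟩
              F₁ fMA (μ2 (F₀ s' x)) A.∘ (μ1 (F₀ plSP (F₀ s' x)) A.∘ F₁ fLA (proj₁ (η (β m) x)))
                ≡⟨ cong (F₁ fMA (μ2 (F₀ s' x)) A.∘_) (A.unflipᵛ (proj₁ (squares x))) ⟩
              F₁ fMA (μ2 (F₀ s' x)) A.∘ (F₁ fMA (a x) A.∘ μ1 (F₀ plSP (F₀ s x)))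
                ≡⟨ sym (A.assoc _ _ _) ⟩
              (F₁ fMA (μ2 (F₀ s' x)) A.∘ F₁ fMA (a x)) A.∘ μ1 (F₀ plSP (F₀ s x))
                ≡⟨ cong (A._∘ μ1 (F₀ plSP (F₀ s x))) (sym (Functor.homomorphism fMA _ _)) ⟩
              F₁ fMA (μ2 (F₀ s' x) M.∘ a x) A.∘ μ1 (F₀ plSP (F₀ s x))
                ≡⟨ cong (λ g → F₁ fMA g A.∘ μ1 (F₀ plSP (F₀ s x)))
                        (sym (plQM-θ3 x)) ⟩
              F₁ fMA (F₁ plQM (η θ3 x) M.∘ μ2 (F₀ s x)) A.∘ μ1 (F₀ plSP (F₀ s x))
                ≡⟨ sym (μ12-absorb (η θ3 x)) ⟩
              F₁ fMA (F₁ plQM (η θ3 x)) A.∘ μ12 (F₀ s x) ∎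
              where open ≡-Reasoning
        θ : NatTrans s s'
        θ = proj₁ (full12 m12)
        e12 = proj₂ (full12 m12)

    faithful-ii : Faithful Cmp3 → Faithful Cmp12 → Faithful Cmp4
    faithful-ii faithful3 faithful12 {s} {s'} θ θ' (eM , eLR) =
      faithful12 θ θ' ((λ x → cong proj₁ (eLR x)) , prSQ-θ)
      where
        plQM-prSQ-θ : ∀ x → F₁ plQM (F₁ prSQ (η θ x)) ≡ F₁ plQM (F₁ prSQ (η θ' x))
        plQM-prSQ-θ x = M.epic (trans (sym (nat2 (η θ x)))
                          (trans (cong (μ2 (F₀ s' x) M.∘_) (eM x)) (nat2 (η θ' x))))
        prSQ-θ = faithful3 (whiskerˡ prSQ θ) (whiskerˡ prSQ θ') (plQM-prSQ-θ , λ x → cong proj₂ (eLR x))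

    module _ (pb1 : IsPullback fLA fMA plPL prPM) where
      open StrictPullback fLA fMA plPL prPM sq1 pb1

      essSurj-iii-23 : EssSurj Cmp4 → EssSurj Cmp23
      essSurj-iii-23 es4 = essSurj-from-morphisms plSP (prQR ∘F prSQ) (≡F⇒NatTrans comm23) reach
        where
          reach : ∀ d → Reaches Cmp23 d
          reach d = s , record
            { α = θ1
            ; β = record { η = λ x → proj₂ (η (β i4) x) ; commute = λ f → cong proj₂ (commute (β i4) f) }
            ; cond = λ x → trans (cong (λ g → η (ν d) x B.∘ F₁ fMB g) (proj₂ e1 x)) (proj₂ (squares x)) }
            where
              μ1⁻¹ = inverseNT (whiskerʳ (≡F⇒NatTrans sq1) (l' d))
              c4 : Pseudocone ⟨ fMA , fMB ⟩F (fLA ×F fRB) X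
              c4 = record
                { l' = prPM ∘F l' d ; r' = ⟨ plPL ∘F l' d , r' d ⟩F
                ; ν = record { η = λ x → η μ1⁻¹ x , η (ν d) x
                             ; commute = λ f → cong₂ _,_ (commute μ1⁻¹ f) (commute (ν d) f) } }
              s : Functor X S
              s = proj₁ (es4 c4)
              i4 : PCMor (CFunctor.F₀ Cmp4 s) c4
              i4 = Iso.from (proj₂ (es4 c4))
              squares = λ x → square4-split refl (cond i4 x)
              m1 : PCMor (CFunctor.F₀ Cmp1 (plSP ∘F s)) (CFunctor.F₀ Cmp1 (l' d))
              m1 = record
                { α = record { η = λ x → proj₁ (η (β i4) x) ; commute = λ f → cong proj₁ (commute (β i4) f) }
                ; β = record { η = η (α i4) ; commute = commute (α i4) }
                ; cond = λ x → A.unflipᵛ (proj₁ (squares x)) }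
              θ1 : NatTrans (plSP ∘F s) (l' d)
              θ1 = proj₁ (comparison-full X m1)
              e1 = proj₂ (comparison-full X m1)

      full-iii-23 : Full Cmp4 → Full Cmp23
      full-iii-23 full4 {s} {s'} m =
        θ , (λ x → jointly-faithful (cong proj₁ (proj₂ e4 x)) (proj₁ e4 x)) , (λ x → cong proj₂ (proj₂ e4 x))
        where
          m4 : PCMor (CFunctor.F₀ Cmp4 s) (CFunctor.F₀ Cmp4 s')
          m4 = record
            { α = let t = whiskerˡ prPM (α m) in record { η = η t ; commute = commute t }
            ; β = let t = whiskerˡ plPL (α m)
                  in record { η = λ x → η t x , η (β m) x
                            ; commute = λ f → cong₂ _,_ (commute t f) (commute (β m) f) }
            ; cond = λ x → square4-join (μ4-components (F₀ s' x)) (A.flipᵛ (nat1 (η (α m) x))) (cond m x) }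
          θ : NatTrans s s'
          θ = proj₁ (full4 m4)
          e4 = proj₂ (full4 m4)

      faithful-iii-23 : Faithful Cmp4 → Faithful Cmp23
      faithful-iii-23 faithful4 θ θ' (eP , eR) =
        faithful4 θ θ' ((λ x → cong (F₁ prPM) (eP x)) , (λ x → cong₂ _,_ (cong (F₁ plPL) (eP x)) (eR x)))

    module _ (pb3 : IsPullback fMB fRB plQM prQR) where
      open StrictPullback fMB fRB plQM prQR sq3 pb3

      essSurj-iii-12 : EssSurj Cmp4 → EssSurj Cmp12
      essSurj-iii-12 es4 = essSurj-from-morphisms (plPL ∘F plSP) prSQ (≡F⇒NatTrans comm12) reach
        where
          reach : ∀ d → Reaches Cmp12 d
          reach d = s , record
            { α = record { η = λ x → proj₁ (η (β i4) x) ; commute = λ f → cong proj₁ (commute (β i4) f) }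
            ; β = θ3
            ; cond = A-square }
            where
              open ≡-Reasoning
              ν⁻¹ = inverseNT (ν d)
              μ3-q = whiskerʳ (≡F⇒NatTrans sq3) (r' d)
              c4 : Pseudocone ⟨ fMA , fMB ⟩F (fLA ×F fRB) X
              c4 = record
                { l' = plQM ∘F r' d ; r' = ⟨ l' d , prQR ∘F r' d ⟩F
                ; ν = record { η = λ x → η ν⁻¹ x , η μ3-q x
                             ; commute = λ f → cong₂ _,_ (commute ν⁻¹ f) (commute μ3-q f) } }
              s : Functor X S
              s = proj₁ (es4 c4)
              i4 : PCMor (CFunctor.F₀ Cmp4 s) c4
              i4 = Iso.from (proj₂ (es4 c4))
              squares = λ x → square4-split refl (cond i4 x)
              αt : NatTrans (plQM ∘F (prSQ ∘F s)) (plQM ∘F r' d)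
              αt = α i4 ∘V inverseNT (μ2NT s)
              αt-μ2 : ∀ x → η αt x M.∘ μ2 (F₀ s x) ≡ η (α i4) x
              αt-μ2 x = M.cancelʳ (M.inverseˡ _)
              m3 : PCMor (CFunctor.F₀ Cmp3 (prSQ ∘F s)) (CFunctor.F₀ Cmp3 (r' d))
              m3 = record
                { α = record { η = η αt ; commute = commute αt }
                ; β = record { η = λ x → proj₂ (η (β i4) x) ; commute = λ f → cong proj₂ (commute (β i4) f) }
                ; cond = λ x → B.epic (begin
                    (μ3 (F₀ (r' d) x) B.∘ F₁ fMB (η αt x)) B.∘ F₁ fMB (μ2 (F₀ s x))
                      ≡⟨ B.assoc _ _ _ ⟩
                    μ3 (F₀ (r' d) x) B.∘ (F₁ fMB (η αt x) B.∘ F₁ fMB (μ2 (F₀ s x)))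
                      ≡⟨ cong (μ3 (F₀ (r' d) x) B.∘_)
                              (trans (sym (Functor.homomorphism fMB _ _)) (cong (F₁ fMB) (αt-μ2 x))) ⟩
                    μ3 (F₀ (r' d) x) B.∘ F₁ fMB (η (α i4) x)
                      ≡⟨ proj₂ (squares x) ⟩
                    F₁ fRB (proj₂ (η (β i4) x)) B.∘ μ23 (F₀ s x)
                      ≡⟨ cong (F₁ fRB (proj₂ (η (β i4) x)) B.∘_) (μ23-pasting (F₀ s x)) ⟩
                    F₁ fRB (proj₂ (η (β i4) x)) B.∘ (μ3 (F₀ prSQ (F₀ s x)) B.∘ F₁ fMB (μ2 (F₀ s x)))
                      ≡⟨ sym (B.assoc _ _ _) ⟩
                    (F₁ fRB (proj₂ (η (β i4) x)) B.∘ μ3 (F₀ prSQ (F₀ s x))) B.∘ F₁ fMB (μ2 (F₀ s x)) ∎) }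
              θ3 : NatTrans (prSQ ∘F s) (r' d)
              θ3 = proj₁ (comparison-full X m3)
              e3 = proj₂ (comparison-full X m3)
              A-square : ∀ x → η (ν d) x A.∘ F₁ fLA (proj₁ (η (β i4) x))
                               ≡ F₁ fMA (F₁ plQM (η θ3 x)) A.∘ μ12 (F₀ s x)
              A-square x = begin
                η (ν d) x A.∘ F₁ fLA (proj₁ (η (β i4) x))
                  ≡⟨ A.unflipᵛ (proj₁ (squares x)) ⟩
                F₁ fMA (η (α i4) x) A.∘ μ1 (F₀ plSP (F₀ s x))
                  ≡⟨ cong (λ g → F₁ fMA g A.∘ μ1 (F₀ plSP (F₀ s x)))
                          (trans (sym (αt-μ2 x)) (cong (M._∘ μ2 (F₀ s x)) (sym (proj₁ e3 x)))) ⟩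
                F₁ fMA (F₁ plQM (η θ3 x) M.∘ μ2 (F₀ s x)) A.∘ μ1 (F₀ plSP (F₀ s x))
                  ≡⟨ sym (μ12-absorb (η θ3 x)) ⟩
                F₁ fMA (F₁ plQM (η θ3 x)) A.∘ μ12 (F₀ s x) ∎

      full-iii-12 : Full Cmp4 → Full Cmp12
      full-iii-12 full4 {s} {s'} m =
        θ , (λ x → cong proj₁ (proj₂ e4 x))
          , (λ x → jointly-faithful (M.epic (trans (sym (nat2 (η θ x)))
                                              (trans (cong (μ2 (F₀ s' x) M.∘_) (proj₁ e4 x)) (μ2-αt x))))
                                    (cong proj₂ (proj₂ e4 x)))
        where
          open ≡-Reasoning
          βQ = η (β m)
          αt : NatTrans ((prPM ∘F plSP) ∘F s) ((prPM ∘F plSP) ∘F s')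
          αt = inverseNT (μ2NT s') ∘V (whiskerˡ plQM (β m) ∘V μ2NT s)
          μ2-αt : ∀ x → μ2 (F₀ s' x) M.∘ η αt x ≡ F₁ plQM (βQ x) M.∘ μ2 (F₀ s x)
          μ2-αt x = M.cancelˡ (M.inverseʳ _)
          A-square : ∀ x → μ1 (F₀ plSP (F₀ s' x)) A.∘ F₁ fLA (η (α m) x)
                           ≡ F₁ fMA (η αt x) A.∘ μ1 (F₀ plSP (F₀ s x))
          A-square x = A.monic (begin
            F₁ fMA (μ2 (F₀ s' x)) A.∘ (μ1 (F₀ plSP (F₀ s' x)) A.∘ F₁ fLA (η (α m) x))
              ≡⟨ sym (A.assoc _ _ _) ⟩
            (F₁ fMA (μ2 (F₀ s' x)) A.∘ μ1 (F₀ plSP (F₀ s' x))) A.∘ F₁ fLA (η (α m) x)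
              ≡⟨ cong (A._∘ F₁ fLA (η (α m) x)) (sym (μ12-pasting (F₀ s' x))) ⟩
            μ12 (F₀ s' x) A.∘ F₁ fLA (η (α m) x)
              ≡⟨ cond m x ⟩
            F₁ fMA (F₁ plQM (βQ x)) A.∘ μ12 (F₀ s x)
              ≡⟨ μ12-absorb (βQ x) ⟩
            F₁ fMA (F₁ plQM (βQ x) M.∘ μ2 (F₀ s x)) A.∘ μ1 (F₀ plSP (F₀ s x))
              ≡⟨ cong (λ g → F₁ fMA g A.∘ μ1 (F₀ plSP (F₀ s x))) (sym (μ2-αt x)) ⟩
            F₁ fMA (μ2 (F₀ s' x) M.∘ η αt x) A.∘ μ1 (F₀ plSP (F₀ s x))
              ≡⟨ cong (A._∘ μ1 (F₀ plSP (F₀ s x))) (Functor.homomorphism fMA _ _) ⟩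
            (F₁ fMA (μ2 (F₀ s' x)) A.∘ F₁ fMA (η αt x)) A.∘ μ1 (F₀ plSP (F₀ s x))
              ≡⟨ A.assoc _ _ _ ⟩
            F₁ fMA (μ2 (F₀ s' x)) A.∘ (F₁ fMA (η αt x) A.∘ μ1 (F₀ plSP (F₀ s x))) ∎)
          B-square : ∀ x → μ23 (F₀ s' x) B.∘ F₁ fMB (η αt x) ≡ F₁ fRB (F₁ prQR (βQ x)) B.∘ μ23 (F₀ s x)
          B-square x = begin
            μ23 (F₀ s' x) B.∘ F₁ fMB (η αt x)
              ≡⟨ cong (B._∘ F₁ fMB (η αt x)) (μ23-pasting (F₀ s' x)) ⟩
            (μ3 (F₀ prSQ (F₀ s' x)) B.∘ F₁ fMB (μ2 (F₀ s' x))) B.∘ F₁ fMB (η αt x)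
              ≡⟨ B.assoc _ _ _ ⟩
            μ3 (F₀ prSQ (F₀ s' x)) B.∘ (F₁ fMB (μ2 (F₀ s' x)) B.∘ F₁ fMB (η αt x))
              ≡⟨ cong (μ3 (F₀ prSQ (F₀ s' x)) B.∘_) (F-resp-square fMB (μ2-αt x)) ⟩
            μ3 (F₀ prSQ (F₀ s' x)) B.∘ (F₁ fMB (F₁ plQM (βQ x)) B.∘ F₁ fMB (μ2 (F₀ s x)))
              ≡⟨ sym (B.assoc _ _ _) ⟩
            (μ3 (F₀ prSQ (F₀ s' x)) B.∘ F₁ fMB (F₁ plQM (βQ x))) B.∘ F₁ fMB (μ2 (F₀ s x))
              ≡⟨ cong (B._∘ F₁ fMB (μ2 (F₀ s x))) (nat3 (βQ x)) ⟩
            (F₁ fRB (F₁ prQR (βQ x)) B.∘ μ3 (F₀ prSQ (F₀ s x))) B.∘ F₁ fMB (μ2 (F₀ s x))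
              ≡⟨ B.assoc _ _ _ ⟩
            F₁ fRB (F₁ prQR (βQ x)) B.∘ (μ3 (F₀ prSQ (F₀ s x)) B.∘ F₁ fMB (μ2 (F₀ s x)))
              ≡⟨ cong (F₁ fRB (F₁ prQR (βQ x)) B.∘_) (sym (μ23-pasting (F₀ s x))) ⟩
            F₁ fRB (F₁ prQR (βQ x)) B.∘ μ23 (F₀ s x) ∎
          m4 : PCMor (CFunctor.F₀ Cmp4 s) (CFunctor.F₀ Cmp4 s')
          m4 = record
            { α = αt
            ; β = let t = whiskerˡ prQR (β m)
                  in record { η = λ x → η (α m) x , η t x
                            ; commute = λ f → cong₂ _,_ (commute (α m) f) (commute t f) }
            ; cond = λ x → square4-join (μ4-components (F₀ s' x)) (A.flipᵛ (A-square x)) (B-square x) }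
          θ : NatTrans s s'
          θ = proj₁ (full4 m4)
          e4 = proj₂ (full4 m4)

      faithful-iii-12 : Faithful Cmp4 → Faithful Cmp12
      faithful-iii-12 faithful4 {s} {s'} θ θ' (eL , eQ) =
        faithful4 θ θ' (prPM-plSP-θ , λ x → cong₂ _,_ (eL x) (cong (F₁ prQR) (eQ x)))
        where
          prPM-plSP-θ : ∀ x → F₁ prPM (F₁ plSP (η θ x)) ≡ F₁ prPM (F₁ plSP (η θ' x))
          prPM-plSP-θ x = M.monic (trans (nat2 (η θ x))
                            (trans (cong (λ g → F₁ plQM g M.∘ μ2 (F₀ s x)) (eQ x)) (sym (nat2 (η θ' x)))))

    ffe-i : FullyFaithfulEssSurj Cmp1 → FullyFaithfulEssSurj Cmp23 → FullyFaithfulEssSurj Cmp4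
    ffe-i e1 e23 = record
      { full = full-i (full e1) (full e23)
      ; faithful = faithful-i (faithful e1) (faithful e23)
      ; essSurj = essSurj-i (essSurj e1) (essSurj e23) }
      where open FullyFaithfulEssSurj

    ffe-ii : FullyFaithfulEssSurj Cmp3 → FullyFaithfulEssSurj Cmp12 → FullyFaithfulEssSurj Cmp4
    ffe-ii e3 e12 = record
      { full = full-ii (full e3) (full e12)
      ; faithful = faithful-ii (faithful e3) (faithful e12)
      ; essSurj = essSurj-ii (essSurj e3) (essSurj e12) }
      where open FullyFaithfulEssSurj

    ffe-iii-12 : IsPullback fMB fRB plQM prQR → FullyFaithfulEssSurj Cmp4 → FullyFaithfulEssSurj Cmp12
    ffe-iii-12 pb3 e4 = record
      { full = full-iii-12 pb3 (full e4)
      ; faithful = faithful-iii-12 pb3 (faithful e4)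
      ; essSurj = essSurj-iii-12 pb3 (essSurj e4) }
      where open FullyFaithfulEssSurj

    ffe-iii-23 : IsPullback fLA fMA plPL prPM → FullyFaithfulEssSurj Cmp4 → FullyFaithfulEssSurj Cmp23
    ffe-iii-23 pb1 e4 = record
      { full = full-iii-23 pb1 (full e4)
      ; faithful = faithful-iii-23 pb1 (faithful e4)
      ; essSurj = essSurj-iii-23 pb1 (essSurj e4) }
      where open FullyFaithfulEssSurj

  Bipullback1 Bipullback3 Bipullback12 Bipullback23 Bipullback4 : Set₁
  Bipullback1 = IsBipullbackSq fLA fMA plPL prPM sq1
  Bipullback3 = IsBipullbackSq fMB fRB plQM prQR sq3
  Bipullback12 = IsBipullbackSq fLA (fMA ∘F plQM) (plPL ∘F plSP) prSQ comm12
  Bipullback23 = IsBipullbackSq (fMB ∘F prPM) fRB plSP (prQR ∘F prSQ) comm23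
  Bipullback4 =
    IsBipullbackSq ⟨ fMA , fMB ⟩F (fLA ×F fRB) (prPM ∘F plSP) ⟨ plPL ∘F plSP , prQR ∘F prSQ ⟩F comm4

  bipullback-i : Bipullback1 → Bipullback23 → Bipullback4
  bipullback-i b1 b23 X = fullyFaithfulEssSurj⇒equivalence
    (ffe-i (equivalence⇒fullyFaithfulEssSurj (b1 X)) (equivalence⇒fullyFaithfulEssSurj (b23 X)))
    where open Comparisons X

  bipullback-ii : Bipullback3 → Bipullback12 → Bipullback4
  bipullback-ii b3 b12 X = fullyFaithfulEssSurj⇒equivalence
    (ffe-ii (equivalence⇒fullyFaithfulEssSurj (b3 X)) (equivalence⇒fullyFaithfulEssSurj (b12 X)))
    where open Comparisons X

  bipullback-iii-12 : IsPullback fMB fRB plQM prQR → Bipullback4 → Bipullback12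
  bipullback-iii-12 pb3 b4 X =
    fullyFaithfulEssSurj⇒equivalence (ffe-iii-12 pb3 (equivalence⇒fullyFaithfulEssSurj (b4 X)))
    where open Comparisons X

  bipullback-iii-23 : IsPullback fLA fMA plPL prPM → Bipullback4 → Bipullback23
  bipullback-iii-23 pb1 b4 X =
    fullyFaithfulEssSurj⇒equivalence (ffe-iii-23 pb1 (equivalence⇒fullyFaithfulEssSurj (b4 X)))
    where open Comparisons X

lemma6 : {L A M B R P Q S : Groupoid}
    (fLA : Functor L A) (fMA : Functor M A) (fMB : Functor M B) (fRB : Functor R B)
    -- (1)
    (plPL : Functor P L) (prPM : Functor P M)
    (sq1 : (fLA ∘F plPL) ≡F (fMA ∘F prPM))
    (pb1 : IsPullback fLA fMA plPL prPM)
    -- (3)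
    (plQM : Functor Q M) (prQR : Functor Q R)
    (sq3 : (fMB ∘F plQM) ≡F (fRB ∘F prQR))
    (pb3 : IsPullback fMB fRB plQM prQR)
    -- (2)
    (plSP : Functor S P) (prSQ : Functor S Q)
    (sq2 : (prPM ∘F plSP) ≡F (plQM ∘F prSQ))
    (pb2 : IsPullback prPM plQM plSP prSQ) →
    let open Squares fLA fMA fMB fRB plPL prPM sq1 plQM prQR sq3 plSP prSQ sq2 in
    -- (4) is a pullback
    IsPullback ⟨ fMA , fMB ⟩F (fLA ×F fRB) (prPM ∘F plSP) ⟨ plPL ∘F plSP , prQR ∘F prSQ ⟩F
    -- (i)
    × (IsBipullbackSq fLA fMA plPL prPM sq1 →
       IsBipullbackSq (fMB ∘F prPM) fRB plSP (prQR ∘F prSQ) comm23 →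
       IsBipullbackSq ⟨ fMA , fMB ⟩F (fLA ×F fRB) (prPM ∘F plSP)
         ⟨ plPL ∘F plSP , prQR ∘F prSQ ⟩F comm4)
    -- (ii)
    × (IsBipullbackSq fMB fRB plQM prQR sq3 →
       IsBipullbackSq fLA (fMA ∘F plQM) (plPL ∘F plSP) prSQ comm12 →
       IsBipullbackSq ⟨ fMA , fMB ⟩F (fLA ×F fRB) (prPM ∘F plSP)
         ⟨ plPL ∘F plSP , prQR ∘F prSQ ⟩F comm4)
    -- (iii)
    × (IsBipullbackSq ⟨ fMA , fMB ⟩F (fLA ×F fRB) (prPM ∘F plSP)
         ⟨ plPL ∘F plSP , prQR ∘F prSQ ⟩F comm4 →
       IsBipullbackSq fLA (fMA ∘F plQM) (plPL ∘F plSP) prSQ comm12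
       × IsBipullbackSq (fMB ∘F prPM) fRB plSP (prQR ∘F prSQ) comm23)
lemma6 fLA fMA fMB fRB plPL prPM sq1 pb1 plQM prQR sq3 pb3 plSP prSQ sq2 pb2 =
    pullback4 pb1 pb3 pb2
  , bipullback-i
  , bipullback-ii
  , λ b4 → bipullback-iii-12 pb3 b4 , bipullback-iii-23 pb1 b4
  where open Pasting fLA fMA fMB fRB plPL prPM sq1 plQM prQR sq3 plSP prSQ sq2
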